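{- For every $\varepsilon_1,\varepsilon_2$ with $\varepsilon_1/24>\varepsilon_2>0$, there exist $\delta>\varepsilon_1^2(\varepsilon_1-24\varepsilon_2)/24^3$ and $N$ such that for every tournament $T$ on $n>N$ vertices with $t(T)\ge(1/24-\delta)n^3$, the set $$B_T(\varepsilon_2)=\left\{\{u,v\}\subseteq V(T): u\ne v,\ \{u,v\}\text{ is contained in at most }\varepsilon_2 n\text{ cyclic triangles of }T\right\}$$ satisfies $|B_T(\varepsilon_2)|<\varepsilon_1 n^2$.
   Context: For a tournament $T$, $t(T)$ denotes the number of cyclic (directed) triangles in $T$.
   Formalization: The parameters ε₁ and ε₂ range only over the rationals, and the witness δ is likewise taken in the rationals. -}

module Defs where

open import Data.Bool using (Bool; true; false; not; _∧_; _∨_; if_then_else_)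
open import Data.Nat using (ℕ; _<ᵇ_)
open import Data.Fin using (Fin; toℕ)
open import Data.List using (List; map; allFin)
open import Data.Nat.ListAction using (sum)
open import Data.Integer using (+_)
open import Data.Rational using (ℚ; _/_; _*_; _≤?_)
open import Relation.Nullary using (does)
open import Relation.Binary.PropositionalEquality using (_≡_; _≢_)

record Tournament (n : ℕ) : Set where
  field
    beats  : Fin n → Fin n → Bool
    irrefl : ∀ u → beats u u ≡ false
    tourn  : ∀ u v → u ≢ v → beats v u ≡ not (beats u v)
open Tournament public

𝟙 : Bool → ℕ
𝟙 true  = 1
𝟙 false = 0

countFin : (n : ℕ) → (Fin n → Bool) → ℕ
countFin n p = sum (map (λ i → 𝟙 (p i)) (allFin n))

_<F_ : ∀ {n} → Fin n → Fin n → Bool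
u <F v = toℕ u <ᵇ toℕ v

cyc3 : ∀ {n} → Tournament n → Fin n → Fin n → Fin n → Bool
cyc3 T u v w = beats T u v ∧ beats T v w ∧ beats T w u

cyclicTriple : ∀ {n} → Tournament n → Fin n → Fin n → Fin n → Bool
cyclicTriple T u v w = cyc3 T u v w ∨ cyc3 T v u w

sumFin : (n : ℕ) → (Fin n → ℕ) → ℕ
sumFin n f = sum (map f (allFin n))

t : ∀ {n} → Tournament n → ℕ
t {n} T = sumFin n λ a → sumFin n λ b → countFin n λ c →
            (a <F b) ∧ (b <F c) ∧ cyclicTriple T a b c

pairDeg : ∀ {n} → Tournament n → Fin n → Fin n → ℕ
pairDeg {n} T u v = countFin n λ w → cyclicTriple T u v w

ℕ→ℚ : ℕ → ℚ
ℕ→ℚ k = + k / 1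

B-size : ∀ {n} → Tournament n → ℚ → ℕ
B-size {n} T ε₂ = sumFin n λ u → countFin n λ v →
  (u <F v) ∧ (does (ℕ→ℚ (pairDeg T u v) ≤? ε₂ * ℕ→ℚ n))

module Submission where

-- For a tournament the number of cyclic triangles is determined by the out-degrees through Σ d
-- and Σ d² (Goodman), so many cyclic triangles force nearly regular out-degrees. For any set G
-- of b arcs, summing d(v) + #{u → w → v} + 1 = #{cyclic triangles on uv} + d(u) over the arcs
-- u → v of G, bounding the squared G-degrees by the 2-paths they span, and using Cauchy–Schwarz
-- and AM–GM gives 6b² + 96 n t(T) ≤ 24 n Σ_{uv ∈ G} #{cyclic triangles on uv} + 4n⁴.
-- For G the arcs on the pairs of B_T(ε₂) every summand is at most ε₂n, which together with
-- t(T) ≥ (1/24 - δ)n³ is incompatible with b ≥ ε₁n² as soon as δ < ε₁(ε₁ - 4ε₂)/16.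
-- For ε₁ > 1 the claim is trivial, since B_T(ε₂) has fewer than n² elements.

open import Data.Bool using (Bool; true; false; _∧_; _∨_)
open import Data.Fin as Fin using (Fin)
open import Data.Product using (∃; _×_; _,_)
open import Relation.Nullary using (Dec; yes; no; does)
open import Relation.Binary.PropositionalEquality
  using (_≡_; refl; sym; trans; cong; cong₂; subst; subst₂; module ≡-Reasoning)

open import Defs

module Counting where

  open import Data.Nat using (ℕ; zero; suc; _+_; _*_; _≤_; z≤n; s≤s)
  open import Data.Nat.Properties
  open import Data.Nat.Tactic.RingSolver using (solve-∀)
  open import Data.List using (tabulate)
  open import Data.List.Properties using (map-tabulate)
  import Data.Nat.ListAction as List
  open import Data.Sum using ([_,_]′)
  open import Function using (_∘_; id)
  open import Algebra.Properties.Semiring.Sum +-*-semiring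
    using (sum; sum-syntax; sum-cong-≗; sum-replicate-zero; ∑-distrib-+; ∑-comm; *-distribˡ-sum; *-distribʳ-sum)

  𝟙≤1 : ∀ b → 𝟙 b ≤ 1
  𝟙≤1 true  = s≤s z≤n
  𝟙≤1 false = z≤n

  𝟙-idem : ∀ b → 𝟙 b * 𝟙 b ≡ 𝟙 b
  𝟙-idem true  = refl
  𝟙-idem false = refl

  𝟙-∧ : ∀ p q → 𝟙 (p ∧ q) ≡ 𝟙 p * 𝟙 q
  𝟙-∧ true  q = sym (+-identityʳ (𝟙 q))
  𝟙-∧ false q = refl

  𝟙-∨ : ∀ p q → 𝟙 p * 𝟙 q ≡ 0 → 𝟙 (p ∨ q) ≡ 𝟙 p + 𝟙 q
  𝟙-∨ true  true  ()
  𝟙-∨ true  false _ = refl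
  𝟙-∨ false q     _ = refl

  δ : ∀ {n} → Fin n → Fin n → ℕ
  δ i j = 𝟙 (does (i Fin.≟ j))

  ∑-mono-≤ : ∀ {n} {f g : Fin n → ℕ} → (∀ i → f i ≤ g i) → sum f ≤ sum g
  ∑-mono-≤ {zero}  f≤g = z≤n
  ∑-mono-≤ {suc n} f≤g = +-mono-≤ (f≤g Fin.zero) (∑-mono-≤ (f≤g ∘ Fin.suc))

  ∑-const : ∀ n c → ∑[ i < n ] c ≡ n * c
  ∑-const zero    c = refl
  ∑-const (suc n) c = cong (c +_) (∑-const n c)

  ∑-δ : ∀ {n} (i : Fin n) (f : Fin n → ℕ) → ∑[ j < n ] (f j * δ j i) ≡ f i
  ∑-δ {suc n} Fin.zero f = begin
    f Fin.zero * 1 + ∑[ j < n ] (f (Fin.suc j) * 0) ≡⟨ cong₂ _+_ (*-identityʳ _) (sum-cong-≗ (*-zeroʳ ∘ f ∘ Fin.suc)) ⟩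
    f Fin.zero + ∑[ j < n ] 0                       ≡⟨ cong (f Fin.zero +_) (sum-replicate-zero n) ⟩
    f Fin.zero + 0                                  ≡⟨ +-identityʳ _ ⟩
    f Fin.zero                                      ∎
    where open ≡-Reasoning
  ∑-δ {suc n} (Fin.suc i) f =
    trans (cong (_+ ∑[ j < n ] (f (Fin.suc j) * δ j i)) (*-zeroʳ (f Fin.zero))) (∑-δ i (f ∘ Fin.suc))

  ∑-tabulate : ∀ {n} (f : Fin n → ℕ) → List.sum (tabulate f) ≡ sum f
  ∑-tabulate {zero}  f = refl
  ∑-tabulate {suc n} f = cong (f Fin.zero +_) (∑-tabulate (f ∘ Fin.suc))

  sumFin≡∑ : ∀ n f → sumFin n f ≡ sum f
  sumFin≡∑ n f = trans (cong List.sum (map-tabulate id f)) (∑-tabulate f)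

  countFin≡∑ : ∀ n p → countFin n p ≡ ∑[ i < n ] 𝟙 (p i)
  countFin≡∑ n p = sumFin≡∑ n (𝟙 ∘ p)

  ∑-distrib-+₃ : ∀ {n} (f g h : Fin n → ℕ) → ∑[ i < n ] (f i + g i + h i) ≡ sum f + sum g + sum h
  ∑-distrib-+₃ {n} f g h = trans (∑-distrib-+ {n} _ h) (cong (_+ sum h) (∑-distrib-+ {n} f g))

  ∑-*-∑ : ∀ {m n} (f : Fin m → ℕ) (g : Fin n → ℕ) → sum f * sum g ≡ ∑[ i < m ] ∑[ j < n ] (f i * g j)
  ∑-*-∑ f g = trans (*-distribʳ-sum (sum g) f) (sum-cong-≗ λ i → *-distribˡ-sum (f i) g)

  ∑³ : ∀ {n} → (Fin n → Fin n → Fin n → ℕ) → ℕ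
  ∑³ {n} f = ∑[ a < n ] ∑[ b < n ] ∑[ c < n ] f a b c

  module _ {n : ℕ} where

    ∑²-cong : ∀ {f g : Fin n → Fin n → ℕ} → (∀ a b → f a b ≡ g a b) →
              ∑[ a < n ] ∑[ b < n ] f a b ≡ ∑[ a < n ] ∑[ b < n ] g a b
    ∑²-cong f≡g = sum-cong-≗ {n} λ a → sum-cong-≗ {n} (f≡g a)

    ∑²-mono-≤ : ∀ {f g : Fin n → Fin n → ℕ} → (∀ a b → f a b ≤ g a b) →
                ∑[ a < n ] ∑[ b < n ] f a b ≤ ∑[ a < n ] ∑[ b < n ] g a b
    ∑²-mono-≤ f≤g = ∑-mono-≤ λ a → ∑-mono-≤ (f≤g a)

    ∑²-distrib-+ : ∀ (f g : Fin n → Fin n → ℕ) →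
                   ∑[ a < n ] ∑[ b < n ] (f a b + g a b) ≡ ∑[ a < n ] ∑[ b < n ] f a b + ∑[ a < n ] ∑[ b < n ] g a b
    ∑²-distrib-+ f g = trans (sum-cong-≗ {n} λ a → ∑-distrib-+ {n} (f a) (g a)) (∑-distrib-+ {n} _ _)

    ∑³-cong : ∀ {f g : Fin n → Fin n → Fin n → ℕ} → (∀ a b c → f a b c ≡ g a b c) → ∑³ f ≡ ∑³ g
    ∑³-cong f≡g = ∑²-cong λ a b → sum-cong-≗ {n} (f≡g a b)

    ∑³-mono-≤ : ∀ {f g : Fin n → Fin n → Fin n → ℕ} → (∀ a b c → f a b c ≤ g a b c) → ∑³ f ≤ ∑³ g
    ∑³-mono-≤ f≤g = ∑²-mono-≤ λ a b → ∑-mono-≤ (f≤g a b)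

    ∑³-distrib-+ : ∀ (f g : Fin n → Fin n → Fin n → ℕ) → ∑³ (λ a b c → f a b c + g a b c) ≡ ∑³ f + ∑³ g
    ∑³-distrib-+ f g = trans (∑²-cong λ a b → ∑-distrib-+ {n} (f a b) (g a b)) (∑²-distrib-+ _ _)

    ∑³-swap₁₂ : ∀ (f : Fin n → Fin n → Fin n → ℕ) → ∑³ f ≡ ∑³ (λ a b c → f b a c)
    ∑³-swap₁₂ f = ∑-comm {n} {n} λ a b → ∑[ c < n ] f a b c

    ∑³-swap₂₃ : ∀ (f : Fin n → Fin n → Fin n → ℕ) → ∑³ f ≡ ∑³ (λ a b c → f a c b)
    ∑³-swap₂₃ f = sum-cong-≗ {n} λ a → ∑-comm {n} {n} (f a)

  2xy≤x²+y² : ∀ x y → 2 * x * y ≤ x * x + y * y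
  2xy≤x²+y² x y = [ ordered , (λ y≤x → subst₂ _≤_ (swap y x) (+-comm (y * y) (x * x)) (ordered y≤x)) ]′ (≤-total x y)
    where
    swap : ∀ x y → 2 * x * y ≡ 2 * y * x
    swap = solve-∀

    ordered : ∀ {x y} → x ≤ y → 2 * x * y ≤ x * x + y * y
    ordered {x} x≤y with k , refl ← m≤n⇒∃[o]m+o≡n x≤y = ≤-trans (m≤m+n _ (k * k)) (≤-reflexive (square x k))
      where
      square : ∀ x k → 2 * x * (x + k) + k * k ≡ x * x + (x + k) * (x + k)
      square = solve-∀

  cauchy-schwarz : ∀ {n} (x : Fin n → ℕ) → sum x * sum x ≤ n * ∑[ i < n ] (x i * x i)
  cauchy-schwarz {n} x = *-cancelˡ-≤ 2 (begin
    2 * (sum x * sum x)                               ≡⟨ cong (2 *_) (∑-*-∑ x x) ⟩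
    2 * ∑[ i < n ] ∑[ j < n ] (x i * x j)              ≡⟨ *-distribˡ-sum {n} 2 _ ⟩
    ∑[ i < n ] (2 * ∑[ j < n ] (x i * x j))            ≡⟨ sum-cong-≗ {n} (λ i → trans (*-distribˡ-sum {n} 2 _) (sum-cong-≗ λ j → sym (*-assoc 2 (x i) (x j)))) ⟩
    ∑[ i < n ] ∑[ j < n ] (2 * x i * x j)              ≤⟨ ∑-mono-≤ (λ i → ∑-mono-≤ λ j → 2xy≤x²+y² (x i) (x j)) ⟩
    ∑[ i < n ] ∑[ j < n ] (x i * x i + x j * x j)      ≡⟨ sum-cong-≗ {n} (λ i → trans (∑-distrib-+ {n} _ _) (cong (_+ Q) (∑-const n _))) ⟩
    ∑[ i < n ] (n * (x i * x i) + Q)                  ≡⟨ ∑-distrib-+ {n} _ _ ⟩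
    ∑[ i < n ] (n * (x i * x i)) + ∑[ i < n ] Q        ≡⟨ cong₂ _+_ (sym (*-distribˡ-sum {n} n _)) (∑-const n Q) ⟩
    n * Q + n * Q                                     ≡⟨ cong (n * Q +_) (sym (+-identityʳ (n * Q))) ⟩
    2 * (n * Q)                                       ∎)
    where
    open ≤-Reasoning
    Q : ℕ
    Q = ∑[ i < n ] (x i * x i)

  -- AM–GM for a + 2m and c + 4d, with the cross term 2ac discarded.
  degree-am-gm : ∀ a c d m → 8 * (a * d) + 4 * m * c + 16 * m * d ≤ a * a + c * c + 16 * (d * d) + 4 * (m * m) + 4 * m * a + 8 * (c * d)
  degree-am-gm a c d m = begin
    8 * (a * d) + 4 * m * c + 16 * m * d                              ≤⟨ m≤m+n _ (2 * a * c) ⟩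
    8 * (a * d) + 4 * m * c + 16 * m * d + 2 * a * c                  ≡⟨ expand-product a c d m ⟩
    2 * (a + 2 * m) * (c + 4 * d)                                     ≤⟨ 2xy≤x²+y² (a + 2 * m) (c + 4 * d) ⟩
    (a + 2 * m) * (a + 2 * m) + (c + 4 * d) * (c + 4 * d)             ≡⟨ expand-squares a c d m ⟩
    a * a + c * c + 16 * (d * d) + 4 * (m * m) + 4 * m * a + 8 * (c * d) ∎
    where
    open ≤-Reasoning
    expand-product : ∀ a c d m → 8 * (a * d) + 4 * m * c + 16 * m * d + 2 * a * c ≡ 2 * (a + 2 * m) * (c + 4 * d)
    expand-product = solve-∀
    expand-squares : ∀ a c d m → (a + 2 * m) * (a + 2 * m) + (c + 4 * d) * (c + 4 * d)
                               ≡ a * a + c * c + 16 * (d * d) + 4 * (m * m) + 4 * m * a + 8 * (c * d)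
    expand-squares = solve-∀

  lt : ∀ {n} → Fin n → Fin n → ℕ
  lt a b = 𝟙 (a <F b)

  lt-trichotomy : ∀ {n} (a b : Fin n) → lt a b + lt b a + δ a b ≡ 1
  lt-trichotomy Fin.zero    Fin.zero    = refl
  lt-trichotomy Fin.zero    (Fin.suc b) = refl
  lt-trichotomy (Fin.suc a) Fin.zero    = refl
  lt-trichotomy (Fin.suc a) (Fin.suc b) = lt-trichotomy a b

  lt+lt≤1 : ∀ {n} (a b : Fin n) → lt a b + lt b a ≤ 1
  lt+lt≤1 a b = subst (lt a b + lt b a ≤_) (lt-trichotomy a b) (m≤m+n _ (δ a b))

  lt-trans : ∀ {n} (a b c : Fin n) → lt a b * lt b c ≤ lt a c
  lt-trans Fin.zero    Fin.zero    c           = z≤n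
  lt-trans Fin.zero    (Fin.suc b) Fin.zero    = z≤n
  lt-trans Fin.zero    (Fin.suc b) (Fin.suc c) = ≤-trans (≤-reflexive (*-identityˡ _)) (𝟙≤1 _)
  lt-trans (Fin.suc a) Fin.zero    c           = z≤n
  lt-trans (Fin.suc a) (Fin.suc b) Fin.zero    = ≤-reflexive (*-zeroʳ (lt a b))
  lt-trans (Fin.suc a) (Fin.suc b) (Fin.suc c) = lt-trans a b c

  -- Read p, q, r, s as a < b, c < b, a < c, c < a: at most one of a < c < b and c < a < b holds.
  below-common-top : ∀ (p q r s : Bool) → 𝟙 r * 𝟙 q ≤ 𝟙 p → 𝟙 s * 𝟙 p ≤ 𝟙 q → 𝟙 r + 𝟙 s ≤ 1 →
                     𝟙 r * 𝟙 q + 𝟙 s * 𝟙 p ≤ 𝟙 p * 𝟙 q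
  below-common-top _     _     true  true  _  _  (s≤s ())
  below-common-top true  false false true  _  ()  _
  below-common-top false true  true  false () _   _
  below-common-top true  true  true  false _  _   _ = ≤ᵇ⇒≤ _ _ _
  below-common-top true  true  false true  _  _   _ = ≤ᵇ⇒≤ _ _ _
  below-common-top true  true  false false _  _   _ = ≤ᵇ⇒≤ _ _ _
  below-common-top true  false true  false _  _   _ = ≤ᵇ⇒≤ _ _ _
  below-common-top true  false false false _  _   _ = ≤ᵇ⇒≤ _ _ _
  below-common-top false true  false true  _  _   _ = ≤ᵇ⇒≤ _ _ _
  below-common-top false true  false false _  _   _ = ≤ᵇ⇒≤ _ _ _
  below-common-top false false true  false _  _   _ = ≤ᵇ⇒≤ _ _ _
  below-common-top false false false true  _  _   _ = ≤ᵇ⇒≤ _ _ _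
  below-common-top false false false false _  _   _ = ≤ᵇ⇒≤ _ _ _

  share-≤ : ∀ x y f → x + y ≤ 1 → x * f + y * f ≤ f
  share-≤ x y f x+y≤1 = begin
    x * f + y * f ≡⟨ *-distribʳ-+ f x y ⟨
    (x + y) * f   ≤⟨ *-monoˡ-≤ f x+y≤1 ⟩
    1 * f         ≡⟨ *-identityˡ f ⟩
    f             ∎
    where open ≤-Reasoning

  ∑-increasing : ∀ {n} → (Fin n → Fin n → Fin n → ℕ) → ℕ
  ∑-increasing F = ∑³ λ a b c → lt a b * lt b c * F a b c

  module _ {n : ℕ} (F : Fin n → Fin n → Fin n → ℕ)
           (F-swap₁₂ : ∀ a b c → F a b c ≡ F b a c)
           (F-swap₂₃ : ∀ a b c → F a b c ≡ F a c b) where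

    private
      ∑-lt₁₂ ∑-below-top : ℕ
      ∑-lt₁₂      = ∑³ λ a b c → lt a b * F a b c
      ∑-below-top = ∑³ λ a b c → lt a b * lt c b * F a b c

      2∑-lt₁₂≤∑ : ∑-lt₁₂ + ∑-lt₁₂ ≤ ∑³ F
      2∑-lt₁₂≤∑ = begin
        ∑-lt₁₂ + ∑-lt₁₂                                         ≡⟨ cong (∑-lt₁₂ +_) swapped ⟩
        ∑-lt₁₂ + ∑³ (λ a b c → lt b a * F a b c)                 ≡⟨ ∑³-distrib-+ {n} _ _ ⟨
        ∑³ (λ a b c → lt a b * F a b c + lt b a * F a b c)      ≤⟨ ∑³-mono-≤ {n} (λ a b c → share-≤ (lt a b) (lt b a) (F a b c) (lt+lt≤1 a b)) ⟩
        ∑³ F                                                    ∎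
        where
        open ≤-Reasoning
        swapped : ∑-lt₁₂ ≡ ∑³ (λ a b c → lt b a * F a b c)
        swapped = trans (∑³-swap₁₂ {n} _) (∑³-cong {n} λ a b c → cong (lt b a *_) (sym (F-swap₁₂ a b c)))

      ∑-increasing+∑-below-top≤ : ∑-increasing F + ∑-below-top ≤ ∑-lt₁₂
      ∑-increasing+∑-below-top≤ = begin
        ∑-increasing F + ∑-below-top                                          ≡⟨ ∑³-distrib-+ {n} _ _ ⟨
        ∑³ (λ a b c → lt a b * lt b c * F a b c + lt a b * lt c b * F a b c)
          ≡⟨ ∑³-cong {n} (λ a b c → factor (lt a b) (lt b c) (lt c b) (F a b c)) ⟩
        ∑³ (λ a b c → lt b c * (lt a b * F a b c) + lt c b * (lt a b * F a b c))
          ≤⟨ ∑³-mono-≤ {n} (λ a b c → share-≤ (lt b c) (lt c b) (lt a b * F a b c) (lt+lt≤1 b c)) ⟩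
        ∑-lt₁₂                                                              ∎
        where
        open ≤-Reasoning
        factor : ∀ x y z f → x * y * f + x * z * f ≡ y * (x * f) + z * (x * f)
        factor = solve-∀

      2∑-increasing≤ : ∑-increasing F + ∑-increasing F ≤ ∑-below-top
      2∑-increasing≤ = begin
        ∑-increasing F + ∑-increasing F                                    ≡⟨ cong₂ _+_ via-a<c<b via-c<a<b ⟩
        ∑³ (λ a b c → lt a c * lt c b * F a b c) + ∑³ (λ a b c → lt c a * lt a b * F a b c) ≡⟨ ∑³-distrib-+ {n} _ _ ⟨
        ∑³ (λ a b c → lt a c * lt c b * F a b c + lt c a * lt a b * F a b c) ≤⟨ ∑³-mono-≤ {n} pointwise ⟩
        ∑-below-top                                                    ∎
        where
        open ≤-Reasoning
        via-a<c<b : ∑-increasing F ≡ ∑³ (λ a b c → lt a c * lt c b * F a b c)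
        via-a<c<b = trans (∑³-swap₂₃ {n} _) (∑³-cong {n} λ a b c → cong (lt a c * lt c b *_) (sym (F-swap₂₃ a b c)))
        via-c<a<b : ∑-increasing F ≡ ∑³ (λ a b c → lt c a * lt a b * F a b c)
        via-c<a<b = trans (∑³-swap₁₂ {n} _) (trans (∑³-swap₂₃ {n} _) (∑³-cong {n} λ a b c →
                      cong (lt c a * lt a b *_) (trans (F-swap₁₂ c a b) (sym (F-swap₂₃ a b c)))))
        factor : ∀ r q s p f → r * q * f + s * p * f ≡ (r * q + s * p) * f
        factor = solve-∀
        pointwise : ∀ a b c → lt a c * lt c b * F a b c + lt c a * lt a b * F a b c ≤ lt a b * lt c b * F a b c
        pointwise a b c = ≤-trans (≤-reflexive (factor (lt a c) (lt c b) (lt c a) (lt a b) (F a b c))) (*-monoˡ-≤ (F a b c)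
          (below-common-top (a <F b) (c <F b) (a <F c) (c <F a) (lt-trans a c b) (lt-trans c a b) (lt+lt≤1 a c)))

    6∑-increasing≤∑ : 6 * ∑-increasing F ≤ ∑³ F
    6∑-increasing≤∑ = begin
      6 * ∑-increasing F       ≡⟨ six (∑-increasing F) ⟩
      3∑ + 3∑                ≤⟨ +-mono-≤ 3∑≤ 3∑≤ ⟩
      ∑-lt₁₂ + ∑-lt₁₂        ≤⟨ 2∑-lt₁₂≤∑ ⟩
      ∑³ F                   ∎
      where
      open ≤-Reasoning
      3∑ : ℕ
      3∑ = ∑-increasing F + ∑-increasing F + ∑-increasing F
      six : ∀ x → 6 * x ≡ x + x + x + (x + x + x)
      six = solve-∀
      3∑≤ : 3∑ ≤ ∑-lt₁₂
      3∑≤ = ≤-trans (≤-reflexive (+-assoc (∑-increasing F) _ _))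
                    (≤-trans (+-monoʳ-≤ (∑-increasing F) 2∑-increasing≤) ∑-increasing+∑-below-top≤)

  module Arcs {n : ℕ} (T : Tournament n) where

    arc : Fin n → Fin n → ℕ
    arc u v = 𝟙 (beats T u v)

    arc-trichotomy : ∀ u v → arc u v + arc v u + δ u v ≡ 1
    arc-trichotomy u v with u Fin.≟ v
    ... | yes refl rewrite irrefl T u = refl
    ... | no u≢v rewrite tourn T u v u≢v with beats T u v
    ...   | true  = refl
    ...   | false = refl

    arc-asym : ∀ u v → arc u v * arc v u ≡ 0
    arc-asym u v with beats T u v | beats T v u | arc-trichotomy u v
    ... | true  | true  | ()
    ... | true  | false | _ = refl
    ... | false | _     | _ = refl

    ∑-split-at : ∀ a (f : Fin n → ℕ) → sum f ≡ ∑[ w < n ] (f w * arc w a) + ∑[ w < n ] (f w * arc a w) + f a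
    ∑-split-at a f = begin
      sum f                                                              ≡⟨ sum-cong-≗ {n} (λ w → expand (f w) (arc-trichotomy w a)) ⟩
      ∑[ w < n ] (f w * arc w a + f w * arc a w + f w * δ w a)           ≡⟨ ∑-distrib-+ {n} _ _ ⟩
      ∑[ w < n ] (f w * arc w a + f w * arc a w) + ∑[ w < n ] (f w * δ w a) ≡⟨ cong₂ _+_ (∑-distrib-+ {n} _ _) (∑-δ a f) ⟩
      ∑[ w < n ] (f w * arc w a) + ∑[ w < n ] (f w * arc a w) + f a      ∎
      where
      open ≡-Reasoning
      expand : ∀ {x y z} p → x + y + z ≡ 1 → p ≡ p * x + p * y + p * z
      expand {x} {y} {z} p x+y+z≡1 = begin
        p                     ≡⟨ *-identityʳ p ⟨
        p * 1                 ≡⟨ cong (p *_) x+y+z≡1 ⟨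
        p * (x + y + z)       ≡⟨ distrib p x y z ⟩
        p * x + p * y + p * z ∎
        where
        distrib : ∀ p x y z → p * (x + y + z) ≡ p * x + p * y + p * z
        distrib = solve-∀

    outdeg indeg : Fin n → ℕ
    outdeg u = ∑[ v < n ] arc u v
    indeg  v = ∑[ u < n ] arc u v

    indeg+outdeg : ∀ x → indeg x + outdeg x + 1 ≡ n
    indeg+outdeg x = begin
      indeg x + outdeg x + 1                                   ≡⟨ cong₂ (λ p q → p + q + 1) (ones (λ w → arc w x)) (ones (arc x)) ⟩
      ∑[ w < n ] (1 * arc w x) + ∑[ w < n ] (1 * arc x w) + 1   ≡⟨ ∑-split-at x (λ _ → 1) ⟨
      ∑[ w < n ] 1                                             ≡⟨ ∑-const n 1 ⟩
      n * 1                                                    ≡⟨ *-identityʳ n ⟩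
      n                                                        ∎
      where
      open ≡-Reasoning
      ones : ∀ g → sum g ≡ ∑[ w < n ] (1 * g w)
      ones g = sum-cong-≗ {n} (λ w → sym (*-identityˡ (g w)))

    ∑outdeg ∑outdeg² : ℕ
    ∑outdeg  = ∑[ x < n ] outdeg x
    ∑outdeg² = ∑[ x < n ] (outdeg x * outdeg x)

    handshake : ∑outdeg + ∑outdeg + n ≡ n * n
    handshake = begin
      ∑outdeg + ∑outdeg + n                  ≡⟨ cong₂ _+_ (cong (_+ ∑outdeg) ∑indeg≡∑outdeg) (*-identityʳ n) ⟨
      ∑[ x < n ] indeg x + ∑outdeg + n * 1   ≡⟨ cong₂ _+_ (∑-distrib-+ {n} indeg outdeg) (∑-const n 1) ⟨
      ∑[ x < n ] (indeg x + outdeg x) + ∑[ x < n ] 1 ≡⟨ ∑-distrib-+ {n} _ _ ⟨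
      ∑[ x < n ] (indeg x + outdeg x + 1)    ≡⟨ sum-cong-≗ {n} indeg+outdeg ⟩
      ∑[ x < n ] n                           ≡⟨ ∑-const n n ⟩
      n * n                                  ∎
      where
      open ≡-Reasoning
      ∑indeg≡∑outdeg : ∑[ x < n ] indeg x ≡ ∑outdeg
      ∑indeg≡∑outdeg = ∑-comm {n} {n} λ x u → arc u x

    ∑indeg*outdeg+∑outdeg² : ∑[ x < n ] (indeg x * outdeg x) + ∑outdeg² + ∑outdeg ≡ n * ∑outdeg
    ∑indeg*outdeg+∑outdeg² = begin
      ∑[ x < n ] (indeg x * outdeg x) + ∑outdeg² + ∑outdeg          ≡⟨ cong (_+ ∑outdeg) (∑-distrib-+ {n} _ _) ⟨
      ∑[ x < n ] (indeg x * outdeg x + outdeg x * outdeg x) + ∑outdeg ≡⟨ ∑-distrib-+ {n} _ _ ⟨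
      ∑[ x < n ] (indeg x * outdeg x + outdeg x * outdeg x + outdeg x)
        ≡⟨ sum-cong-≗ {n} (λ x → trans (factor (indeg x) (outdeg x)) (cong (_* outdeg x) (indeg+outdeg x))) ⟩
      ∑[ x < n ] (n * outdeg x)                                    ≡⟨ *-distribˡ-sum {n} n outdeg ⟨
      n * ∑outdeg                                                  ∎
      where
      open ≡-Reasoning
      factor : ∀ i o → i * o + o * o + o ≡ (i + o + 1) * o
      factor = solve-∀

    ∑³-split : (h : Fin n → Fin n → Fin n → ℕ) →
               ∑³ h ≡ ∑³ (λ x a c → h x a c * arc c a) + ∑³ (λ x a c → h x a c * arc a c) + ∑[ x < n ] ∑[ a < n ] h x a a
    ∑³-split h = begin
      ∑³ h                                                                          ≡⟨ ∑²-cong {n} (λ x a → ∑-split-at a (h x a)) ⟩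
      ∑[ x < n ] ∑[ a < n ] (∑[ c < n ] (h x a c * arc c a) + ∑[ c < n ] (h x a c * arc a c) + h x a a)
                                                                                    ≡⟨ ∑²-distrib-+ {n} _ _ ⟩
      ∑[ x < n ] ∑[ a < n ] (∑[ c < n ] (h x a c * arc c a) + ∑[ c < n ] (h x a c * arc a c)) + ∑[ x < n ] ∑[ a < n ] h x a a
                                                                                    ≡⟨ cong (_+ _) (∑²-distrib-+ {n} _ _) ⟩
      ∑³ (λ x a c → h x a c * arc c a) + ∑³ (λ x a c → h x a c * arc a c) + ∑[ x < n ] ∑[ a < n ] h x a a ∎
      where open ≡-Reasoning

    #cyclic #transitive : ℕ
    #cyclic     = ∑³ λ a b c → arc a b * arc b c * arc c a
    #transitive = ∑³ λ a b c → arc a b * arc b c * arc a c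

    #cyclic+#transitive : #cyclic + #transitive ≡ ∑[ x < n ] (indeg x * outdeg x)
    #cyclic+#transitive = begin
      #cyclic + #transitive                             ≡⟨ cong₂ _+_ (∑³-swap₁₂ {n} _) (∑³-swap₁₂ {n} _) ⟩
      S₁ + S₂                                         ≡⟨ +-identityʳ _ ⟨
      S₁ + S₂ + 0                                     ≡⟨ cong (S₁ + S₂ +_) no-2-cycles ⟨
      S₁ + S₂ + ∑[ x < n ] ∑[ a < n ] h x a a          ≡⟨ ∑³-split h ⟨
      ∑³ h                                            ≡⟨ sum-cong-≗ {n} (λ x → ∑-*-∑ (λ a → arc a x) (arc x)) ⟨
      ∑[ x < n ] (indeg x * outdeg x)                 ∎
      where
      open ≡-Reasoning
      h : Fin n → Fin n → Fin n → ℕ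
      h x a c = arc a x * arc x c
      S₁ S₂ : ℕ
      S₁ = ∑³ λ x a c → h x a c * arc c a
      S₂ = ∑³ λ x a c → h x a c * arc a c
      no-2-cycles : ∑[ x < n ] ∑[ a < n ] h x a a ≡ 0
      no-2-cycles = trans (∑²-cong {n} λ x a → arc-asym a x) (trans (sum-cong-≗ {n} λ _ → sum-replicate-zero n) (sum-replicate-zero n))

    #transitive+#transitive : #transitive + #transitive + ∑outdeg ≡ ∑outdeg²
    #transitive+#transitive = begin
      #transitive + #transitive + ∑outdeg               ≡⟨ cong₂ (λ p q → p + q + ∑outdeg) via-sink via-middle ⟩
      S₁ + S₂ + ∑outdeg                               ≡⟨ cong (S₁ + S₂ +_) (∑²-cong {n} λ b a → 𝟙-idem (beats T b a)) ⟨
      S₁ + S₂ + ∑[ b < n ] ∑[ a < n ] h b a a          ≡⟨ ∑³-split h ⟨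
      ∑³ h                                            ≡⟨ sum-cong-≗ {n} (λ b → ∑-*-∑ (arc b) (arc b)) ⟨
      ∑outdeg²                                        ∎
      where
      open ≡-Reasoning
      h : Fin n → Fin n → Fin n → ℕ
      h b a c = arc b a * arc b c
      S₁ S₂ : ℕ
      S₁ = ∑³ λ b a c → h b a c * arc c a
      S₂ = ∑³ λ b a c → h b a c * arc a c
      rot : ∀ x y z → x * y * z ≡ z * x * y
      rot = solve-∀
      swap : ∀ x y z → x * y * z ≡ x * z * y
      swap = solve-∀
      via-sink : #transitive ≡ S₁
      via-sink = trans (∑³-swap₂₃ {n} _) (∑³-cong {n} λ b a c → rot (arc b c) (arc c a) (arc b a))
      via-middle : #transitive ≡ S₂
      via-middle = ∑³-cong {n} λ b a c → swap (arc b a) (arc a c) (arc b c)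

    goodman : #cyclic + #cyclic + 3 * ∑outdeg² + ∑outdeg ≡ 2 * (n * ∑outdeg)
    goodman = begin
      #cyclic + #cyclic + 3 * ∑outdeg² + ∑outdeg
        ≡⟨ split-one #cyclic ∑outdeg² ∑outdeg ⟩
      #cyclic + #cyclic + 2 * ∑outdeg² + ∑outdeg² + ∑outdeg
        ≡⟨ cong (λ z → #cyclic + #cyclic + 2 * ∑outdeg² + z + ∑outdeg) #transitive+#transitive ⟨
      #cyclic + #cyclic + 2 * ∑outdeg² + (#transitive + #transitive + ∑outdeg) + ∑outdeg
        ≡⟨ regroup #cyclic #transitive ∑outdeg² ∑outdeg ⟩
      2 * (#cyclic + #transitive + ∑outdeg² + ∑outdeg)
        ≡⟨ cong (λ z → 2 * (z + ∑outdeg² + ∑outdeg)) #cyclic+#transitive ⟩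
      2 * (∑[ x < n ] (indeg x * outdeg x) + ∑outdeg² + ∑outdeg)
        ≡⟨ cong (2 *_) ∑indeg*outdeg+∑outdeg² ⟩
      2 * (n * ∑outdeg)                                                          ∎
      where
      open ≡-Reasoning
      split-one : ∀ c q s → c + c + 3 * q + s ≡ c + c + 2 * q + q + s
      split-one = solve-∀
      regroup : ∀ c p q s → c + c + 2 * q + (p + p + s) + s ≡ 2 * (c + p + q + s)
      regroup = solve-∀

    cyclicTriple-𝟙 : ∀ a b c → 𝟙 (cyclicTriple T a b c) ≡ arc a b * arc b c * arc c a + arc b a * arc a c * arc c b
    cyclicTriple-𝟙 a b c = trans (𝟙-∨ (cyc3 T a b c) (cyc3 T b a c) disjoint) (cong₂ _+_ (𝟙-cyc3 a b c) (𝟙-cyc3 b a c))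
      where
      open ≡-Reasoning
      𝟙-cyc3 : ∀ a b c → 𝟙 (cyc3 T a b c) ≡ arc a b * arc b c * arc c a
      𝟙-cyc3 a b c = begin
        𝟙 (cyc3 T a b c)                 ≡⟨ 𝟙-∧ (beats T a b) _ ⟩
        arc a b * 𝟙 (beats T b c ∧ beats T c a) ≡⟨ cong (arc a b *_) (𝟙-∧ (beats T b c) _) ⟩
        arc a b * (arc b c * arc c a)    ≡⟨ *-assoc (arc a b) _ _ ⟨
        arc a b * arc b c * arc c a      ∎
      disjoint : 𝟙 (cyc3 T a b c) * 𝟙 (cyc3 T b a c) ≡ 0
      disjoint = begin
        𝟙 (cyc3 T a b c) * 𝟙 (cyc3 T b a c)                       ≡⟨ cong₂ _*_ (𝟙-cyc3 a b c) (𝟙-cyc3 b a c) ⟩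
        arc a b * arc b c * arc c a * (arc b a * arc a c * arc c b) ≡⟨ regroup (arc a b) (arc b a) _ _ _ _ ⟩
        arc a b * arc b a * (arc b c * arc c a * arc a c * arc c b) ≡⟨ cong (_* (arc b c * arc c a * arc a c * arc c b)) (arc-asym a b) ⟩
        0                                                         ∎
        where
        regroup : ∀ x x' y z y' z' → x * y * z * (x' * y' * z') ≡ x * x' * (y * z * y' * z')
        regroup = solve-∀

    cyclic𝟙 : Fin n → Fin n → Fin n → ℕ
    cyclic𝟙 a b c = 𝟙 (cyclicTriple T a b c)

    cyclic𝟙-swap₁₂ : ∀ a b c → cyclic𝟙 a b c ≡ cyclic𝟙 b a c
    cyclic𝟙-swap₁₂ a b c = trans (cyclicTriple-𝟙 a b c) (trans (+-comm (arc a b * arc b c * arc c a) _) (sym (cyclicTriple-𝟙 b a c)))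

    cyclic𝟙-swap₂₃ : ∀ a b c → cyclic𝟙 a b c ≡ cyclic𝟙 a c b
    cyclic𝟙-swap₂₃ a b c = trans (cyclicTriple-𝟙 a b c) (trans (rotations (arc a b) (arc b c) (arc c a) (arc b a) (arc a c) (arc c b))
                                                            (sym (cyclicTriple-𝟙 a c b)))
      where
      rotations : ∀ x y z x' y' z' → x * y * z + x' * y' * z' ≡ y' * z' * x' + z * x * y
      rotations = solve-∀

    t≡∑-increasing : t T ≡ ∑-increasing cyclic𝟙
    t≡∑-increasing = trans (sumFin≡∑ n _) (sum-cong-≗ {n} λ a → trans (sumFin≡∑ n _) (sum-cong-≗ {n} λ b →
      trans (countFin≡∑ n _) (sum-cong-≗ {n} λ c → begin
        𝟙 ((a <F b) ∧ (b <F c) ∧ cyclicTriple T a b c) ≡⟨ 𝟙-∧ (a <F b) _ ⟩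
        lt a b * 𝟙 ((b <F c) ∧ cyclicTriple T a b c)    ≡⟨ cong (lt a b *_) (𝟙-∧ (b <F c) _) ⟩
        lt a b * (lt b c * cyclic𝟙 a b c)               ≡⟨ *-assoc (lt a b) _ _ ⟨
        lt a b * lt b c * cyclic𝟙 a b c                 ∎)))
      where open ≡-Reasoning

    ∑cyclic𝟙 : ∑³ cyclic𝟙 ≡ #cyclic + #cyclic
    ∑cyclic𝟙 = trans (∑³-cong {n} cyclicTriple-𝟙) (trans (∑³-distrib-+ {n} _ _) (cong (#cyclic +_) (sym (∑³-swap₁₂ {n} _))))

    6t≤2#cyclic : 6 * t T ≤ #cyclic + #cyclic
    6t≤2#cyclic = subst₂ (λ x y → 6 * x ≤ y) (sym t≡∑-increasing) ∑cyclic𝟙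
                         (6∑-increasing≤∑ cyclic𝟙 cyclic𝟙-swap₁₂ cyclic𝟙-swap₂₃)

    reverse-arc : ∀ {u v} → arc u v ≡ 1 → arc v u ≡ 0
    reverse-arc {u} {v} uv = trans (sym (*-identityˡ (arc v u))) (subst (λ z → z * arc v u ≡ 0) uv (arc-asym u v))

    paths : Fin n → Fin n → ℕ
    paths u v = ∑[ w < n ] (arc u w * arc w v)

    pairDeg-of-arc : ∀ {u v} → arc u v ≡ 1 → pairDeg T u v ≡ ∑[ w < n ] (arc v w * arc w u)
    pairDeg-of-arc {u} {v} uv = trans (countFin≡∑ n _) (sum-cong-≗ {n} λ w → begin
      𝟙 (cyclicTriple T u v w)                                  ≡⟨ cyclicTriple-𝟙 u v w ⟩
      arc u v * arc v w * arc w u + arc v u * arc u w * arc w v ≡⟨ cong₂ (λ x y → x * arc v w * arc w u + y * arc u w * arc w v) uv (reverse-arc uv) ⟩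
      1 * arc v w * arc w u + 0 * arc u w * arc w v             ≡⟨ simplify (arc v w) (arc w u) (arc u w * arc w v) ⟩
      arc v w * arc w u                                         ∎)
      where
      open ≡-Reasoning
      simplify : ∀ x y z → 1 * x * y + 0 * z ≡ x * y
      simplify = solve-∀

    outdeg-along-arc : ∀ {u v} → arc u v ≡ 1 → outdeg v + paths u v + 1 ≡ pairDeg T u v + outdeg u
    outdeg-along-arc {u} {v} uv = begin
      outdeg v + paths u v + 1                                      ≡⟨ cong (λ z → z + paths u v + 1) (∑-split-at u (arc v)) ⟩
      ∑[ w < n ] (arc v w * arc w u) + common′ + arc v u + paths u v + 1
                                                                    ≡⟨ cong₂ (λ x y → x + common′ + y + paths u v + 1) (sym (pairDeg-of-arc uv)) (reverse-arc uv) ⟩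
      pairDeg T u v + common′ + 0 + paths u v + 1                   ≡⟨ cong (λ z → pairDeg T u v + z + 0 + paths u v + 1) (sum-cong-≗ {n} λ w → *-comm (arc v w) (arc u w)) ⟩
      pairDeg T u v + common + 0 + paths u v + 1                    ≡⟨ regroup (pairDeg T u v) common (paths u v) ⟩
      pairDeg T u v + (paths u v + common + 1)                      ≡⟨ cong (λ z → pairDeg T u v + (paths u v + common + z)) uv ⟨
      pairDeg T u v + (paths u v + common + arc u v)                ≡⟨ cong (pairDeg T u v +_) (∑-split-at v (arc u)) ⟨
      pairDeg T u v + outdeg u                                      ∎
      where
      open ≡-Reasoning
      common common′ : ℕ
      common  = ∑[ w < n ] (arc u w * arc v w)
      common′ = ∑[ w < n ] (arc v w * arc u w)
      regroup : ∀ p c q → p + c + 0 + q + 1 ≡ p + (q + c + 1)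
      regroup = solve-∀

    spanned : (Fin n → ℕ) → ℕ
    spanned g = ∑[ v < n ] ∑[ w < n ] (g v * g w * arc w v)

    ∑-indicator² : ∀ (g : Fin n → ℕ) → (∀ v → g v * g v ≡ g v) → sum g * sum g ≡ spanned g + spanned g + sum g
    ∑-indicator² g g-idem = begin
      sum g * sum g                                             ≡⟨ ∑-*-∑ g g ⟩
      ∑[ v < n ] ∑[ w < n ] (g v * g w)                          ≡⟨ sum-cong-≗ {n} (λ v → ∑-split-at v (λ w → g v * g w)) ⟩
      ∑[ v < n ] (∑[ w < n ] (g v * g w * arc w v) + ∑[ w < n ] (g v * g w * arc v w) + g v * g v)
                                                                ≡⟨ ∑-distrib-+ {n} _ _ ⟩
      ∑[ v < n ] (∑[ w < n ] (g v * g w * arc w v) + ∑[ w < n ] (g v * g w * arc v w)) + ∑[ v < n ] (g v * g v)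
                                                                ≡⟨ cong₂ _+_ (∑-distrib-+ {n} _ _) (sum-cong-≗ {n} g-idem) ⟩
      spanned g + ∑[ v < n ] ∑[ w < n ] (g v * g w * arc v w) + sum g ≡⟨ cong (λ z → spanned g + z + sum g) reversed ⟩
      spanned g + spanned g + sum g                             ∎
      where
      open ≡-Reasoning
      reversed : ∑[ v < n ] ∑[ w < n ] (g v * g w * arc v w) ≡ spanned g
      reversed = trans (∑-comm {n} {n} _) (∑²-cong {n} λ a b → cong (_* arc b a) (*-comm (g b) (g a)))

    pairDeg-sym : ∀ u v → pairDeg T u v ≡ pairDeg T v u
    pairDeg-sym u v = trans (countFin≡∑ n _) (trans (sum-cong-≗ {n} (cyclic𝟙-swap₁₂ u v)) (sym (countFin≡∑ n _)))

    ∑-pairs≡∑-arcs : ∀ (h : Fin n → Fin n → ℕ) → (∀ u v → h u v ≡ h v u) →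
                     ∑[ u < n ] ∑[ v < n ] (lt u v * h u v) ≡ ∑[ u < n ] ∑[ v < n ] (arc u v * h u v)
    ∑-pairs≡∑-arcs h h-sym = *-cancelˡ-≡ _ _ 2 (begin
      2 * ∑[ u < n ] ∑[ v < n ] (lt u v * h u v)                ≡⟨ symmetrise lt ⟨
      ∑[ u < n ] ∑[ v < n ] ((lt u v + lt v u) * h u v)          ≡⟨ ∑²-cong {n} (λ u v → cong (_* h u v) (lt+lt≡arc+arc u v)) ⟩
      ∑[ u < n ] ∑[ v < n ] ((arc u v + arc v u) * h u v)        ≡⟨ symmetrise arc ⟩
      2 * ∑[ u < n ] ∑[ v < n ] (arc u v * h u v)               ∎)
      where
      open ≡-Reasoning
      lt+lt≡arc+arc : ∀ u v → lt u v + lt v u ≡ arc u v + arc v u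
      lt+lt≡arc+arc u v = +-cancelʳ-≡ (δ u v) _ _ (trans (lt-trichotomy u v) (sym (arc-trichotomy u v)))
      symmetrise : ∀ f → ∑[ u < n ] ∑[ v < n ] ((f u v + f v u) * h u v) ≡ 2 * ∑[ u < n ] ∑[ v < n ] (f u v * h u v)
      symmetrise f = begin
        ∑[ u < n ] ∑[ v < n ] ((f u v + f v u) * h u v)                 ≡⟨ ∑²-cong {n} (λ u v → *-distribʳ-+ (h u v) (f u v) (f v u)) ⟩
        ∑[ u < n ] ∑[ v < n ] (f u v * h u v + f v u * h u v)           ≡⟨ ∑²-distrib-+ {n} _ _ ⟩
        ∑[ u < n ] ∑[ v < n ] (f u v * h u v) + ∑[ u < n ] ∑[ v < n ] (f v u * h u v)
                                                                        ≡⟨ cong (∑[ u < n ] ∑[ v < n ] (f u v * h u v) +_) swapped ⟩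
        ∑[ u < n ] ∑[ v < n ] (f u v * h u v) + ∑[ u < n ] ∑[ v < n ] (f u v * h u v)
                                                                        ≡⟨ cong (∑[ u < n ] ∑[ v < n ] (f u v * h u v) +_) (+-identityʳ _) ⟨
        2 * ∑[ u < n ] ∑[ v < n ] (f u v * h u v)                       ∎
        where
        swapped : ∑[ u < n ] ∑[ v < n ] (f v u * h u v) ≡ ∑[ u < n ] ∑[ v < n ] (f u v * h u v)
        swapped = trans (∑-comm {n} {n} _) (∑²-cong {n} λ v u → cong (f v u *_) (h-sym u v))

  module ChosenArcs {n : ℕ} (T : Tournament n) (S : Fin n → Fin n → Bool) where

    open Arcs T

    chosen : Fin n → Fin n → ℕ
    chosen u v = 𝟙 (beats T u v ∧ S u v)

    chosen≤arc : ∀ u v → chosen u v ≤ arc u v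
    chosen≤arc u v with beats T u v
    ... | true  = 𝟙≤1 (S u v)
    ... | false = z≤n

    chosenOut chosenIn : Fin n → ℕ
    chosenOut u = ∑[ v < n ] chosen u v
    chosenIn  v = ∑[ u < n ] chosen u v

    #chosen ∑chosenPaths ∑chosenPairDeg : ℕ
    #chosen         = ∑[ u < n ] chosenOut u
    ∑chosenPaths    = ∑[ u < n ] ∑[ v < n ] (chosen u v * paths u v)
    ∑chosenPairDeg  = ∑[ u < n ] ∑[ v < n ] (chosen u v * pairDeg T u v)

    ∑chosenOut² ∑chosenIn² : ℕ
    ∑chosenOut² = ∑[ u < n ] (chosenOut u * chosenOut u)
    ∑chosenIn²  = ∑[ v < n ] (chosenIn v * chosenIn v)

    #chosen≤n² : #chosen ≤ n * n
    #chosen≤n² = begin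
      ∑[ u < n ] ∑[ v < n ] chosen u v ≤⟨ ∑²-mono-≤ {n} (λ u v → 𝟙≤1 (beats T u v ∧ S u v)) ⟩
      ∑[ u < n ] ∑[ v < n ] 1         ≡⟨ sum-cong-≗ {n} (λ _ → trans (∑-const n 1) (*-identityʳ n)) ⟩
      ∑[ u < n ] n                    ≡⟨ ∑-const n n ⟩
      n * n                           ∎
      where open ≤-Reasoning

    ∑chosenIn : ∑[ v < n ] chosenIn v ≡ #chosen
    ∑chosenIn = ∑-comm {n} {n} λ v u → chosen u v

    ∑chosenOut²≤ : ∑chosenOut² ≤ ∑chosenPaths + ∑chosenPaths + #chosen
    ∑chosenOut²≤ = begin
      ∑[ u < n ] (chosenOut u * chosenOut u)                    ≡⟨ sum-cong-≗ {n} (λ u → ∑-indicator² (chosen u) (λ v → 𝟙-idem _)) ⟩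
      ∑[ u < n ] (spanned (chosen u) + spanned (chosen u) + chosenOut u) ≤⟨ ∑-mono-≤ (λ u → +-monoˡ-≤ (chosenOut u) (+-mono-≤ (spanned≤ u) (spanned≤ u))) ⟩
      ∑[ u < n ] (W u + W u + chosenOut u)                      ≡⟨ ∑-distrib-+₃ W W chosenOut ⟩
      ∑chosenPaths + ∑chosenPaths + #chosen                     ∎
      where
      open ≤-Reasoning
      W : Fin n → ℕ
      W u = ∑[ v < n ] (chosen u v * paths u v)
      spanned≤ : ∀ u → spanned (chosen u) ≤ W u
      spanned≤ u = ∑-mono-≤ λ v → begin
        ∑[ w < n ] (chosen u v * chosen u w * arc w v)           ≤⟨ ∑-mono-≤ (λ w → *-monoˡ-≤ (arc w v) (*-monoʳ-≤ (chosen u v) (chosen≤arc u w))) ⟩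
        ∑[ w < n ] (chosen u v * arc u w * arc w v)              ≡⟨ sum-cong-≗ {n} (λ w → *-assoc (chosen u v) _ _) ⟩
        ∑[ w < n ] (chosen u v * (arc u w * arc w v))            ≡⟨ *-distribˡ-sum {n} (chosen u v) _ ⟨
        chosen u v * paths u v                                  ∎

    ∑chosenIn²≤ : ∑chosenIn² ≤ ∑chosenPaths + ∑chosenPaths + #chosen
    ∑chosenIn²≤ = begin
      ∑[ v < n ] (chosenIn v * chosenIn v)                      ≡⟨ sum-cong-≗ {n} (λ v → ∑-indicator² (λ u → chosen u v) (λ u → 𝟙-idem _)) ⟩
      ∑[ v < n ] (spanned (λ u → chosen u v) + spanned (λ u → chosen u v) + chosenIn v)
                                                                ≤⟨ ∑-mono-≤ (λ v → +-monoˡ-≤ (chosenIn v) (+-mono-≤ (spanned≤ v) (spanned≤ v))) ⟩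
      ∑[ v < n ] (W v + W v + chosenIn v)                       ≡⟨ ∑-distrib-+₃ W W chosenIn ⟩
      ∑[ v < n ] W v + ∑[ v < n ] W v + ∑[ v < n ] chosenIn v   ≡⟨ cong₂ _+_ (cong₂ _+_ ∑W ∑W) ∑chosenIn ⟩
      ∑chosenPaths + ∑chosenPaths + #chosen                     ∎
      where
      open ≤-Reasoning
      W : Fin n → ℕ
      W v = ∑[ w < n ] (chosen w v * paths w v)
      ∑W : ∑[ v < n ] W v ≡ ∑chosenPaths
      ∑W = ∑-comm {n} {n} λ v w → chosen w v * paths w v
      spanned≤ : ∀ v → spanned (λ u → chosen u v) ≤ W v
      spanned≤ v = begin
        ∑[ a < n ] ∑[ b < n ] (chosen a v * chosen b v * arc b a) ≤⟨ ∑²-mono-≤ {n} pointwise ⟩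
        ∑[ a < n ] ∑[ b < n ] (chosen b v * (arc b a * arc a v))   ≡⟨ ∑-comm {n} {n} _ ⟩
        ∑[ b < n ] ∑[ a < n ] (chosen b v * (arc b a * arc a v))   ≡⟨ sum-cong-≗ {n} (λ b → *-distribˡ-sum {n} (chosen b v) _) ⟨
        W v                                                       ∎
        where
        rearrange : ∀ x y z → x * y * z ≡ y * (z * x)
        rearrange = solve-∀
        pointwise : ∀ a b → chosen a v * chosen b v * arc b a ≤ chosen b v * (arc b a * arc a v)
        pointwise a b = ≤-trans (*-monoˡ-≤ (arc b a) (*-monoˡ-≤ (chosen b v) (chosen≤arc a v)))
                                (≤-reflexive (rearrange (arc a v) (chosen b v) (arc b a)))

    ∑chosenIn*outdeg ∑chosenOut*outdeg : ℕ
    ∑chosenIn*outdeg  = ∑[ v < n ] (chosenIn v * outdeg v)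
    ∑chosenOut*outdeg = ∑[ u < n ] (chosenOut u * outdeg u)

    chosen-*-cong : ∀ u v {x y} → (arc u v ≡ 1 → x ≡ y) → chosen u v * x ≡ chosen u v * y
    chosen-*-cong u v h with beats T u v
    ... | false = refl
    ... | true  = cong (𝟙 (S u v) *_) (h refl)

    chosen-along-arc : ∀ u v → chosen u v * paths u v + chosen u v * outdeg v + chosen u v ≡ chosen u v * pairDeg T u v + chosen u v * outdeg u
    chosen-along-arc u v = begin
      c * paths u v + c * outdeg v + c       ≡⟨ factor c (paths u v) (outdeg v) ⟩
      c * (outdeg v + paths u v + 1)         ≡⟨ chosen-*-cong u v outdeg-along-arc ⟩
      c * (pairDeg T u v + outdeg u)         ≡⟨ *-distribˡ-+ c _ _ ⟩
      c * pairDeg T u v + c * outdeg u       ∎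
      where
      open ≡-Reasoning
      c : ℕ
      c = chosen u v
      factor : ∀ c p d → c * p + c * d + c ≡ c * (d + p + 1)
      factor = solve-∀

    ∑chosen-along-arcs : ∑chosenPaths + ∑chosenIn*outdeg + #chosen ≡ ∑chosenPairDeg + ∑chosenOut*outdeg
    ∑chosen-along-arcs = begin
      ∑chosenPaths + ∑chosenIn*outdeg + #chosen                                ≡⟨ cong (λ z → ∑chosenPaths + z + #chosen) by-head ⟩
      ∑chosenPaths + ∑[ u < n ] ∑[ v < n ] (chosen u v * outdeg v) + #chosen   ≡⟨ ∑-distrib-+₃ {n} _ _ _ ⟨
      ∑[ u < n ] (∑[ v < n ] (chosen u v * paths u v) + ∑[ v < n ] (chosen u v * outdeg v) + chosenOut u)
                                                                               ≡⟨ sum-cong-≗ {n} (λ u → ∑-distrib-+₃ {n} _ _ _) ⟨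
      ∑[ u < n ] ∑[ v < n ] (chosen u v * paths u v + chosen u v * outdeg v + chosen u v)
                                                                               ≡⟨ ∑²-cong {n} chosen-along-arc ⟩
      ∑[ u < n ] ∑[ v < n ] (chosen u v * pairDeg T u v + chosen u v * outdeg u) ≡⟨ ∑²-distrib-+ {n} _ _ ⟩
      ∑chosenPairDeg + ∑[ u < n ] ∑[ v < n ] (chosen u v * outdeg u)           ≡⟨ cong (∑chosenPairDeg +_) (sum-cong-≗ {n} λ u → *-distribʳ-sum {n} (outdeg u) (chosen u)) ⟨
      ∑chosenPairDeg + ∑chosenOut*outdeg                                       ∎
      where
      open ≡-Reasoning
      by-head : ∑chosenIn*outdeg ≡ ∑[ u < n ] ∑[ v < n ] (chosen u v * outdeg v)
      by-head = trans (sum-cong-≗ {n} λ v → *-distribʳ-sum {n} (outdeg v) (λ u → chosen u v)) (∑-comm {n} {n} _)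

    ∑-degree-am-gm : ∀ m → 8 * ∑chosenOut*outdeg + 4 * m * #chosen + 16 * m * ∑outdeg
                         ≤ ∑chosenOut² + ∑chosenIn² + 16 * ∑outdeg² + n * (4 * (m * m)) + 4 * m * #chosen + 8 * ∑chosenIn*outdeg
    ∑-degree-am-gm m = begin
      8 * ∑chosenOut*outdeg + 4 * m * #chosen + 16 * m * ∑outdeg
        ≡⟨ cong₂ (λ x y → x + 4 * m * y + 16 * m * ∑outdeg) (*-distribˡ-sum {n} 8 _) (sym ∑chosenIn) ⟩
      ∑[ x < n ] (8 * (chosenOut x * outdeg x)) + 4 * m * ∑[ x < n ] chosenIn x + 16 * m * ∑outdeg
        ≡⟨ cong₂ (λ y z → ∑[ x < n ] (8 * (chosenOut x * outdeg x)) + y + z) (*-distribˡ-sum {n} (4 * m) _) (*-distribˡ-sum {n} (16 * m) _) ⟩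
      ∑[ x < n ] (8 * (chosenOut x * outdeg x)) + ∑[ x < n ] (4 * m * chosenIn x) + ∑[ x < n ] (16 * m * outdeg x)
        ≡⟨ ∑-distrib-+₃ {n} _ _ _ ⟨
      ∑[ x < n ] (8 * (chosenOut x * outdeg x) + 4 * m * chosenIn x + 16 * m * outdeg x)
        ≤⟨ ∑-mono-≤ (λ x → degree-am-gm (chosenOut x) (chosenIn x) (outdeg x) m) ⟩
      ∑[ x < n ] (chosenOut x * chosenOut x + chosenIn x * chosenIn x + 16 * (outdeg x * outdeg x)
                  + 4 * (m * m) + 4 * m * chosenOut x + 8 * (chosenIn x * outdeg x))
        ≡⟨ ∑-distrib-+₃ {n} _ _ _ ⟩
      ∑[ x < n ] (chosenOut x * chosenOut x + chosenIn x * chosenIn x + 16 * (outdeg x * outdeg x) + 4 * (m * m))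
        + ∑[ x < n ] (4 * m * chosenOut x) + ∑[ x < n ] (8 * (chosenIn x * outdeg x))
        ≡⟨ cong (λ z → z + ∑[ x < n ] (4 * m * chosenOut x) + ∑[ x < n ] (8 * (chosenIn x * outdeg x)))
                (trans (∑-distrib-+₃ {n} _ _ _) (cong (λ z → z + ∑[ x < n ] (16 * (outdeg x * outdeg x)) + ∑[ x < n ] (4 * (m * m))) (∑-distrib-+ {n} _ _))) ⟩
      ∑chosenOut² + ∑chosenIn² + ∑[ x < n ] (16 * (outdeg x * outdeg x)) + ∑[ x < n ] (4 * (m * m))
        + ∑[ x < n ] (4 * m * chosenOut x) + ∑[ x < n ] (8 * (chosenIn x * outdeg x))
        ≡⟨ cong₂ (λ y z → ∑chosenOut² + ∑chosenIn² + y + z + ∑[ x < n ] (4 * m * chosenOut x) + ∑[ x < n ] (8 * (chosenIn x * outdeg x)))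
                 (*-distribˡ-sum {n} 16 _) (sym (∑-const n (4 * (m * m)))) ⟨
      ∑chosenOut² + ∑chosenIn² + 16 * ∑outdeg² + n * (4 * (m * m))
        + ∑[ x < n ] (4 * m * chosenOut x) + ∑[ x < n ] (8 * (chosenIn x * outdeg x))
        ≡⟨ cong₂ (λ y z → ∑chosenOut² + ∑chosenIn² + 16 * ∑outdeg² + n * (4 * (m * m)) + y + z)
                 (*-distribˡ-sum {n} (4 * m) _) (*-distribˡ-sum {n} 8 _) ⟨
      ∑chosenOut² + ∑chosenIn² + 16 * ∑outdeg² + n * (4 * (m * m)) + 4 * m * #chosen + 8 * ∑chosenIn*outdeg ∎
      where open ≤-Reasoning

    chosen-arcs-bound : ∀ m → ∑chosenOut² + ∑chosenIn² + 4 * #chosen + 16 * m * ∑outdeg ≤ 8 * ∑chosenPairDeg + 16 * ∑outdeg² + n * (4 * (m * m))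
    chosen-arcs-bound m = +-cancelʳ-≤ (X + Y + 4 * m * b + 8 * Ki) _ _ (begin
      X + Y + 4 * b + 16 * m * Sd + (X + Y + 4 * m * b + 8 * Ki) ≡⟨ regroup₁ X Y b m Sd Ki ⟩
      (X + X) + (Y + Y) + 4 * b + 4 * m * b + 8 * Ki + 16 * m * Sd
        ≤⟨ +-monoˡ-≤ (16 * m * Sd) (+-monoˡ-≤ (8 * Ki) (+-monoˡ-≤ (4 * m * b) (+-monoˡ-≤ (4 * b)
             (+-mono-≤ (+-mono-≤ ∑chosenOut²≤ ∑chosenOut²≤) (+-mono-≤ ∑chosenIn²≤ ∑chosenIn²≤))))) ⟩
      (W + W + b + (W + W + b)) + (W + W + b + (W + W + b)) + 4 * b + 4 * m * b + 8 * Ki + 16 * m * Sd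
                                                                  ≡⟨ regroup₂ W b m Ki Sd ⟩
      8 * (W + Ki + b) + 4 * m * b + 16 * m * Sd                  ≡⟨ cong (λ z → 8 * z + 4 * m * b + 16 * m * Sd) ∑chosen-along-arcs ⟩
      8 * (PB + Ko) + 4 * m * b + 16 * m * Sd                     ≡⟨ regroup₃ PB Ko m b Sd ⟩
      8 * PB + (8 * Ko + 4 * m * b + 16 * m * Sd)                  ≤⟨ +-monoʳ-≤ (8 * PB) (∑-degree-am-gm m) ⟩
      8 * PB + (X + Y + 16 * Sd2 + R + 4 * m * b + 8 * Ki)        ≡⟨ regroup₄ PB X Y Sd2 R m b Ki ⟩
      8 * PB + 16 * Sd2 + R + (X + Y + 4 * m * b + 8 * Ki)        ∎)
      where
      open ≤-Reasoning
      X Y W b PB Ko Ki Sd Sd2 R : ℕ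
      X = ∑chosenOut²
      Y = ∑chosenIn²
      W = ∑chosenPaths
      b = #chosen
      PB = ∑chosenPairDeg
      Ko = ∑chosenOut*outdeg
      Ki = ∑chosenIn*outdeg
      Sd = ∑outdeg
      Sd2 = ∑outdeg²
      R = n * (4 * (m * m))
      regroup₁ : ∀ X Y b m Sd Ki → X + Y + 4 * b + 16 * m * Sd + (X + Y + 4 * m * b + 8 * Ki)
                                 ≡ (X + X) + (Y + Y) + 4 * b + 4 * m * b + 8 * Ki + 16 * m * Sd
      regroup₁ = solve-∀
      regroup₂ : ∀ W b m Ki Sd → (W + W + b + (W + W + b)) + (W + W + b + (W + W + b)) + 4 * b + 4 * m * b + 8 * Ki + 16 * m * Sd
                               ≡ 8 * (W + Ki + b) + 4 * m * b + 16 * m * Sd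
      regroup₂ = solve-∀
      regroup₃ : ∀ PB Ko m b Sd → 8 * (PB + Ko) + 4 * m * b + 16 * m * Sd ≡ 8 * PB + (8 * Ko + 4 * m * b + 16 * m * Sd)
      regroup₃ = solve-∀
      regroup₄ : ∀ PB X Y Sd2 R m b Ki → 8 * PB + (X + Y + 16 * Sd2 + R + 4 * m * b + 8 * Ki)
                                       ≡ 8 * PB + 16 * Sd2 + R + (X + Y + 4 * m * b + 8 * Ki)
      regroup₄ = solve-∀

  module KeyInequality {m : ℕ} (T : Tournament (suc m)) (S : Fin (suc m) → Fin (suc m) → Bool) where

    open Arcs T
    open ChosenArcs T S

    private
      n : ℕ
      n = suc m

    2∑outdeg : ∑outdeg + ∑outdeg ≡ n * m
    2∑outdeg = +-cancelʳ-≡ n _ _ (trans handshake (trans (*-suc n m) (+-comm n (n * m))))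

    triangle-bound : 12 * t T + 6 * ∑outdeg² + n * m ≤ 2 * n * (n * m)
    triangle-bound = begin
      12 * t T + 6 * ∑outdeg² + n * m                 ≤⟨ +-monoˡ-≤ (n * m) (+-monoˡ-≤ (6 * ∑outdeg²) (≤-trans (≤-reflexive (twice (t T))) (*-monoʳ-≤ 2 6t≤2#cyclic))) ⟩
      2 * (#cyclic + #cyclic) + 6 * ∑outdeg² + n * m    ≡⟨ cong (2 * (#cyclic + #cyclic) + 6 * ∑outdeg² +_) 2∑outdeg ⟨
      2 * (#cyclic + #cyclic) + 6 * ∑outdeg² + (∑outdeg + ∑outdeg) ≡⟨ regroup #cyclic ∑outdeg² ∑outdeg ⟩
      2 * (#cyclic + #cyclic + 3 * ∑outdeg² + ∑outdeg)  ≡⟨ cong (2 *_) goodman ⟩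
      2 * (2 * (n * ∑outdeg))                         ≡⟨ doubled n ∑outdeg ⟩
      2 * n * (∑outdeg + ∑outdeg)                     ≡⟨ cong (2 * n *_) 2∑outdeg ⟩
      2 * n * (n * m)                                 ∎
      where
      open ≤-Reasoning
      twice : ∀ t → 12 * t ≡ 2 * (6 * t)
      twice = solve-∀
      regroup : ∀ c q s → 2 * (c + c) + 6 * q + (s + s) ≡ 2 * (c + c + 3 * q + s)
      regroup = solve-∀
      doubled : ∀ n s → 2 * (2 * (n * s)) ≡ 2 * n * (s + s)
      doubled = solve-∀

    chosen-arcs-bound′ : ∑chosenOut² + ∑chosenIn² + 4 * #chosen + 4 * (n * (m * m)) ≤ 8 * ∑chosenPairDeg + 16 * ∑outdeg²
    chosen-arcs-bound′ = +-cancelʳ-≤ (n * (4 * (m * m))) _ _ (begin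
      ∑chosenOut² + ∑chosenIn² + 4 * #chosen + 4 * (n * (m * m)) + n * (4 * (m * m))
                                                            ≡⟨ regroup (∑chosenOut² + ∑chosenIn² + 4 * #chosen) n m ⟩
      ∑chosenOut² + ∑chosenIn² + 4 * #chosen + 8 * m * (n * m) ≡⟨ cong (λ z → ∑chosenOut² + ∑chosenIn² + 4 * #chosen + 8 * m * z) 2∑outdeg ⟨
      ∑chosenOut² + ∑chosenIn² + 4 * #chosen + 8 * m * (∑outdeg + ∑outdeg) ≡⟨ cong (∑chosenOut² + ∑chosenIn² + 4 * #chosen +_) (eight m ∑outdeg) ⟩
      ∑chosenOut² + ∑chosenIn² + 4 * #chosen + 16 * m * ∑outdeg ≤⟨ chosen-arcs-bound m ⟩
      8 * ∑chosenPairDeg + 16 * ∑outdeg² + n * (4 * (m * m)) ∎)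
      where
      open ≤-Reasoning
      regroup : ∀ x n m → x + 4 * (n * (m * m)) + n * (4 * (m * m)) ≡ x + 8 * m * (n * m)
      regroup = solve-∀
      eight : ∀ m s → 8 * m * (s + s) ≡ 16 * m * s
      eight = solve-∀

    #chosen²≤ : #chosen * #chosen + #chosen * #chosen ≤ n * (∑chosenOut² + ∑chosenIn²)
    #chosen²≤ = subst (#chosen * #chosen + #chosen * #chosen ≤_) (sym (*-distribˡ-+ n ∑chosenOut² ∑chosenIn²))
      (+-mono-≤ (cauchy-schwarz chosenOut) (subst (λ b → b * b ≤ n * ∑chosenIn²) ∑chosenIn (cauchy-schwarz chosenIn)))

    key-inequality-suc : 6 * (#chosen * #chosen) + 96 * n * t T ≤ 24 * n * ∑chosenPairDeg + 4 * (n * n * n * n)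
    key-inequality-suc = +-cancelʳ-≤ J _ _ (begin
      6 * (b * b) + 96 * n * t T + J                        ≤⟨ m≤m+n _ (12 * n * b) ⟩
      6 * (b * b) + 96 * n * t T + J + 12 * n * b           ≡⟨ regroup₁ b n (t T) Sd2 m ⟩
      3 * (b * b + b * b) + 8 * n * (12 * t T + 6 * Sd2 + n * m) + 3 * n * (4 * b + 4 * (n * (m * m)))
          ≤⟨ +-monoˡ-≤ _ (+-mono-≤ (*-monoʳ-≤ 3 #chosen²≤) (*-monoʳ-≤ (8 * n) triangle-bound)) ⟩
      3 * (n * (X + Y)) + 8 * n * (2 * n * (n * m)) + 3 * n * (4 * b + 4 * (n * (m * m)))
                                                            ≡⟨ regroup₂ n X Y b m ⟩
      3 * n * (X + Y + 4 * b + 4 * (n * (m * m))) + 16 * n * (n * (n * m))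
          ≤⟨ +-monoˡ-≤ _ (*-monoʳ-≤ (3 * n) chosen-arcs-bound′) ⟩
      3 * n * (8 * PB + 16 * Sd2) + 16 * n * (n * (n * m))
          ≤⟨ m≤m+n _ (4 * (n * n)) ⟩
      3 * n * (8 * PB + 16 * Sd2) + 16 * n * (n * (n * m)) + 4 * (n * n)
                                                            ≡⟨ regroup₃ m PB Sd2 ⟩
      24 * n * PB + 4 * (n * n * n * n) + J                 ∎)
      where
      open ≤-Reasoning
      b X Y PB Sd2 J : ℕ
      b = #chosen
      X = ∑chosenOut²
      Y = ∑chosenIn²
      PB = ∑chosenPairDeg
      Sd2 = ∑outdeg²
      J = 48 * n * Sd2 + 8 * n * (n * m) + 12 * n * (n * (m * m))
      regroup₁ : ∀ b n t q m → 6 * (b * b) + 96 * n * t + (48 * n * q + 8 * n * (n * m) + 12 * n * (n * (m * m))) + 12 * n * b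
                             ≡ 3 * (b * b + b * b) + 8 * n * (12 * t + 6 * q + n * m) + 3 * n * (4 * b + 4 * (n * (m * m)))
      regroup₁ = solve-∀
      regroup₂ : ∀ n X Y b m → 3 * (n * (X + Y)) + 8 * n * (2 * n * (n * m)) + 3 * n * (4 * b + 4 * (n * (m * m)))
                             ≡ 3 * n * (X + Y + 4 * b + 4 * (n * (m * m))) + 16 * n * (n * (n * m))
      regroup₂ = solve-∀
      regroup₃ : ∀ m P q → 3 * (1 + m) * (8 * P + 16 * q) + 16 * (1 + m) * ((1 + m) * ((1 + m) * m)) + 4 * ((1 + m) * (1 + m))
                         ≡ 24 * (1 + m) * P + 4 * ((1 + m) * (1 + m) * (1 + m) * (1 + m))
                           + (48 * (1 + m) * q + 8 * (1 + m) * ((1 + m) * m) + 12 * (1 + m) * ((1 + m) * (m * m)))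
      regroup₃ = solve-∀

  key-inequality : ∀ {n} (T : Tournament n) (S : Fin n → Fin n → Bool) → let open ChosenArcs T S in
                   6 * (#chosen * #chosen) + 96 * n * t T ≤ 24 * n * ∑chosenPairDeg + 4 * (n * n * n * n)
  key-inequality {zero}  T S = z≤n
  key-inequality {suc m} T S = KeyInequality.key-inequality-suc T S

open import Data.Nat using (ℕ; zero; suc)
import Data.Nat as ℕ
import Data.Nat.Properties as ℕ
open import Data.Integer as ℤ using (+_)
import Data.Integer.Properties as ℤ
open import Data.Rational
open import Data.Rational.Properties
import Data.Rational.Unnormalised as ℚᵘ
import Data.Rational.Unnormalised.Properties as ℚᵘ
open import Data.Empty using (⊥)
open import Function using (_∘_)
open import Algebra.Properties.Semiring.Sum ℕ.+-*-semiring using (sum; sum-syntax; sum-cong-≗)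

open Counting

toℚᵘ-ℕ→ℚ : ∀ k → toℚᵘ (ℕ→ℚ k) ℚᵘ.≃ ℚᵘ.mkℚᵘ (+ k) 0
toℚᵘ-ℕ→ℚ k = toℚᵘ-fromℚᵘ (ℚᵘ.mkℚᵘ (+ k) 0)

ℕ→ℚ-+ : ∀ a b → ℕ→ℚ (a ℕ.+ b) ≡ ℕ→ℚ a + ℕ→ℚ b
ℕ→ℚ-+ a b = toℚᵘ-injective (ℚᵘ.≃-trans (toℚᵘ-ℕ→ℚ (a ℕ.+ b)) (ℚᵘ.≃-trans sum-of-integers
  (ℚᵘ.≃-sym (ℚᵘ.≃-trans (toℚᵘ-homo-+ (ℕ→ℚ a) (ℕ→ℚ b)) (ℚᵘ.+-cong (toℚᵘ-ℕ→ℚ a) (toℚᵘ-ℕ→ℚ b))))))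
  where
  sum-of-integers : ℚᵘ.mkℚᵘ (+ (a ℕ.+ b)) 0 ℚᵘ.≃ ℚᵘ.mkℚᵘ (+ a) 0 ℚᵘ.+ ℚᵘ.mkℚᵘ (+ b) 0
  sum-of-integers = ℚᵘ.*≡* (trans (ℤ.*-identityʳ _) (sym (trans (ℤ.*-identityʳ _)
    (trans (cong₂ ℤ._+_ (ℤ.*-identityʳ (+ a)) (ℤ.*-identityʳ (+ b))) (sym (ℤ.pos-+ a b))))))

ℕ→ℚ-* : ∀ a b → ℕ→ℚ (a ℕ.* b) ≡ ℕ→ℚ a * ℕ→ℚ b
ℕ→ℚ-* a b = toℚᵘ-injective (ℚᵘ.≃-trans (toℚᵘ-ℕ→ℚ (a ℕ.* b)) (ℚᵘ.≃-trans product-of-integers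
  (ℚᵘ.≃-sym (ℚᵘ.≃-trans (toℚᵘ-homo-* (ℕ→ℚ a) (ℕ→ℚ b)) (ℚᵘ.*-cong (toℚᵘ-ℕ→ℚ a) (toℚᵘ-ℕ→ℚ b))))))
  where
  product-of-integers : ℚᵘ.mkℚᵘ (+ (a ℕ.* b)) 0 ℚᵘ.≃ ℚᵘ.mkℚᵘ (+ a) 0 ℚᵘ.* ℚᵘ.mkℚᵘ (+ b) 0
  product-of-integers = ℚᵘ.*≡* (trans (ℤ.*-identityʳ _) (sym (trans (ℤ.*-identityʳ _) (sym (ℤ.pos-* a b)))))

ℕ→ℚ-mono-≤ : ∀ {a b} → a ℕ.≤ b → ℕ→ℚ a ≤ ℕ→ℚ b
ℕ→ℚ-mono-≤ {a} {b} a≤b = toℚᵘ-cancel-≤ (ℚᵘ.≤-respʳ-≃ (ℚᵘ.≃-sym (toℚᵘ-ℕ→ℚ b)) (ℚᵘ.≤-respˡ-≃ (ℚᵘ.≃-sym (toℚᵘ-ℕ→ℚ a))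
  (ℚᵘ.*≤* (ℤ.*-monoʳ-≤-nonNeg (+ 1) (ℤ.+≤+ a≤b)))))

0<ℕ→ℚ-suc : ∀ k → 0ℚ < ℕ→ℚ (suc k)
0<ℕ→ℚ-suc k = toℚᵘ-cancel-< (ℚᵘ.<-respʳ-≃ (ℚᵘ.≃-sym (toℚᵘ-ℕ→ℚ (suc k))) (ℚᵘ.*<* (ℤ.+<+ (ℕ.s≤s ℕ.z≤n))))

0<ℕ→ℚ : ∀ {k} → 0 ℕ.< k → 0ℚ < ℕ→ℚ k
0<ℕ→ℚ {suc k} _ = 0<ℕ→ℚ-suc k

0≤ℕ→ℚ : ∀ k → 0ℚ ≤ ℕ→ℚ k
0≤ℕ→ℚ k = ℕ→ℚ-mono-≤ {0} {k} ℕ.z≤n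

p≤q⇒0≤q-p : ∀ {p q} → p ≤ q → 0ℚ ≤ q - p
p≤q⇒0≤q-p {p} {q} p≤q = subst (_≤ q - p) (+-inverseʳ p) (+-monoˡ-≤ (- p) p≤q)

p<q⇒0<q-p : ∀ {p q} → p < q → 0ℚ < q - p
p<q⇒0<q-p {p} {q} p<q = subst (_< q - p) (+-inverseʳ p) (+-monoˡ-< (- p) p<q)

p<p+q : ∀ {p q} → 0ℚ < q → p < p + q
p<p+q {p} {q} 0<q = subst (_< p + q) (+-identityʳ p) (+-monoʳ-< p 0<q)

0≤* : ∀ {p q} → 0ℚ ≤ p → 0ℚ ≤ q → 0ℚ ≤ p * q
0≤* {p} {q} 0≤p 0≤q = subst (_≤ p * q) (*-zeroʳ p) (*-monoˡ-≤-nonNeg p {{nonNegative 0≤p}} 0≤q)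

0<* : ∀ {p q} → 0ℚ < p → 0ℚ < q → 0ℚ < p * q
0<* {p} {q} 0<p 0<q = subst (_< p * q) (*-zeroʳ p) (*-monoʳ-<-pos p {{positive 0<p}} 0<q)

-- Exceeds the bound of the statement and, for ε₁ ≤ 1, stays below the threshold
-- ε₁(ε₁ - 4ε₂)/16 of `too-many-bad-pairs`.
δ₀ : ℚ → ℚ → ℚ
δ₀ ε₁ ε₂ = ε₁ * ε₁ * (ε₁ - (+ 24 / 1) * ε₂) * (+ 1 / 13824) + ε₁ * (ε₁ - (+ 4 / 1) * ε₂) * (+ 1 / 32)

module _ where
  open import Data.Rational.Solver using (module +-*-Solver)
  open +-*-Solver

  ε₁-via-s : ∀ ε₁ ε₂ → ε₁ ≡ (+ 24 / 1) * (ε₁ * (+ 1 / 24) - ε₂ + ε₂)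
  ε₁-via-s = solve 2 (λ ε₁ ε₂ → ε₁ := con (+ 24 / 1) :* (ε₁ :* con (+ 1 / 24) :- ε₂ :+ ε₂)) refl

  ε₁-4ε₂-via-s : ∀ ε₁ ε₂ → ε₁ - (+ 4 / 1) * ε₂ ≡ (+ 24 / 1) * (ε₁ * (+ 1 / 24) - ε₂) + (+ 20 / 1) * ε₂
  ε₁-4ε₂-via-s = solve 2 (λ ε₁ ε₂ → ε₁ :- con (+ 4 / 1) :* ε₂ := con (+ 24 / 1) :* (ε₁ :* con (+ 1 / 24) :- ε₂) :+ con (+ 20 / 1) :* ε₂) refl

  δ₀-certificate : ∀ ε₁ ε₂ → ε₁ * (ε₁ - (+ 4 / 1) * ε₂) * (+ 1 / 16)
    ≡ δ₀ ε₁ ε₂ + ε₁ * ((1ℚ - ε₁) * ((+ 24 / 1) * (ε₁ * (+ 1 / 24) - ε₂)) + (+ 10344 / 1) * (ε₁ * (+ 1 / 24) - ε₂) + (+ 8640 / 1) * ε₂) * (+ 1 / 13824)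
  δ₀-certificate = solve 2 (λ ε₁ ε₂ → ε₁ :* (ε₁ :- con (+ 4 / 1) :* ε₂) :* con (+ 1 / 16)
    := (ε₁ :* ε₁ :* (ε₁ :- con (+ 24 / 1) :* ε₂) :* con (+ 1 / 13824) :+ ε₁ :* (ε₁ :- con (+ 4 / 1) :* ε₂) :* con (+ 1 / 32))
       :+ ε₁ :* ((con 1ℚ :- ε₁) :* (con (+ 24 / 1) :* (ε₁ :* con (+ 1 / 24) :- ε₂)) :+ con (+ 10344 / 1) :* (ε₁ :* con (+ 1 / 24) :- ε₂)
                 :+ con (+ 8640 / 1) :* ε₂) :* con (+ 1 / 13824)) refl

  -- Writing β = b - ε₁n² and γ = ε₁ - 4ε₂: the hypotheses of `too-many-bad-pairs` give
  -- 6b(b - 4ε₂n²) ≤ 96δn⁴, while 6b(b - 4ε₂n²) = 6β² + 6β(ε₁ + γ)n² + 6ε₁γn⁴.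
  slack-certificate : ∀ b n t P ε₁ ε₂ δ →
    ((+ 24 / 1) * n * P + (+ 4 / 1) * (n * n * n * n)) - ((+ 6 / 1) * (b * b) + (+ 96 / 1) * n * t)
    + (+ 24 / 1) * n * (ε₂ * n * b - P)
    + (+ 96 / 1) * n * (t - (+ 1 / 24 - δ) * (n * n * n))
    + (+ 6 / 1) * ((b - ε₁ * (n * n)) * (b - ε₁ * (n * n)))
    + (+ 6 / 1) * ((b - ε₁ * (n * n)) * (ε₁ + (ε₁ - (+ 4 / 1) * ε₂)) * (n * n))
    + (+ 96 / 1) * ((ε₁ * (ε₁ - (+ 4 / 1) * ε₂) * (+ 1 / 16) - δ) * ((n * n) * (n * n)))
    ≡ 0ℚ
  slack-certificate = solve 7 (λ b n t P ε₁ ε₂ δ →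
    ((con (+ 24 / 1) :* n :* P :+ con (+ 4 / 1) :* (n :* n :* n :* n)) :- (con (+ 6 / 1) :* (b :* b) :+ con (+ 96 / 1) :* n :* t))
    :+ con (+ 24 / 1) :* n :* (ε₂ :* n :* b :- P)
    :+ con (+ 96 / 1) :* n :* (t :- (con (+ 1 / 24) :- δ) :* (n :* n :* n))
    :+ con (+ 6 / 1) :* ((b :- ε₁ :* (n :* n)) :* (b :- ε₁ :* (n :* n)))
    :+ con (+ 6 / 1) :* ((b :- ε₁ :* (n :* n)) :* (ε₁ :+ (ε₁ :- con (+ 4 / 1) :* ε₂)) :* (n :* n))
    :+ con (+ 96 / 1) :* ((ε₁ :* (ε₁ :- con (+ 4 / 1) :* ε₂) :* con (+ 1 / 16) :- δ) :* ((n :* n) :* (n :* n)))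
    := con 0ℚ) refl

too-many-bad-pairs : ∀ {b n t P ε₁ ε₂ δ} → 0ℚ < n → 0ℚ < ε₁ → 0ℚ < ε₁ - (+ 4 / 1) * ε₂ →
  δ < ε₁ * (ε₁ - (+ 4 / 1) * ε₂) * (+ 1 / 16) →
  (+ 6 / 1) * (b * b) + (+ 96 / 1) * n * t ≤ (+ 24 / 1) * n * P + (+ 4 / 1) * (n * n * n * n) →
  P ≤ ε₂ * n * b →
  (+ 1 / 24 - δ) * (n * n * n) ≤ t →
  ε₁ * (n * n) ≤ b → ⊥
too-many-bad-pairs {b} {n} {t} {P} {ε₁} {ε₂} {δ} 0<n 0<ε₁ 0<γ δ< key P≤ t≥ b≥ =
  <-irrefl (sym (slack-certificate b n t P ε₁ ε₂ δ))
    (+-mono-≤-< (+-mono-≤ (+-mono-≤ (+-mono-≤ (+-mono-≤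
      (p≤q⇒0≤q-p key)
      (0≤* (0≤* (0≤ℕ→ℚ 24) 0≤n) (p≤q⇒0≤q-p P≤)))
      (0≤* (0≤* (0≤ℕ→ℚ 96) 0≤n) (p≤q⇒0≤q-p t≥)))
      (0≤* (0≤ℕ→ℚ 6) (0≤* 0≤β 0≤β)))
      (0≤* (0≤ℕ→ℚ 6) (0≤* (0≤* 0≤β (<⇒≤ (+-mono-< 0<ε₁ 0<γ))) (<⇒≤ 0<n²))))
      (0<* (0<ℕ→ℚ-suc 95) (0<* (p<q⇒0<q-p δ<) (0<* 0<n² 0<n²))))
  where
  0≤n : 0ℚ ≤ n
  0≤n = <⇒≤ 0<n
  0<n² : 0ℚ < n * n
  0<n² = 0<* 0<n 0<n
  0≤β : 0ℚ ≤ b - ε₁ * (n * n)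
  0≤β = p≤q⇒0≤q-p b≥

module _ (ε₁ ε₂ : ℚ) (0<ε₂ : 0ℚ < ε₂) (ε₂<ε₁/24 : ε₂ < ε₁ * (+ 1 / 24)) where

  private
    0<s : 0ℚ < ε₁ * (+ 1 / 24) - ε₂
    0<s = p<q⇒0<q-p ε₂<ε₁/24

  0<ε₁ : 0ℚ < ε₁
  0<ε₁ = subst (0ℚ <_) (sym (ε₁-via-s ε₁ ε₂)) (0<* (0<ℕ→ℚ-suc 23) (+-mono-<-≤ 0<s (<⇒≤ 0<ε₂)))

  0<ε₁-4ε₂ : 0ℚ < ε₁ - (+ 4 / 1) * ε₂
  0<ε₁-4ε₂ = subst (0ℚ <_) (sym (ε₁-4ε₂-via-s ε₁ ε₂)) (+-mono-<-≤ (0<* (0<ℕ→ℚ-suc 23) 0<s) (0≤* (0≤ℕ→ℚ 20) (<⇒≤ 0<ε₂)))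

  bound<δ₀ : ε₁ * ε₁ * (ε₁ - (+ 24 / 1) * ε₂) * (+ 1 / 13824) < δ₀ ε₁ ε₂
  bound<δ₀ = p<p+q (0<* (0<* 0<ε₁ 0<ε₁-4ε₂) (positive⁻¹ (+ 1 / 32)))

  δ₀<ε₁γ/16 : ε₁ ≤ 1ℚ → δ₀ ε₁ ε₂ < ε₁ * (ε₁ - (+ 4 / 1) * ε₂) * (+ 1 / 16)
  δ₀<ε₁γ/16 ε₁≤1 = subst (δ₀ ε₁ ε₂ <_) (sym (δ₀-certificate ε₁ ε₂)) (p<p+q (0<* (0<* 0<ε₁
    (+-mono-<-≤ (+-mono-≤-< (0≤* (p≤q⇒0≤q-p ε₁≤1) (0≤* (0≤ℕ→ℚ 24) (<⇒≤ 0<s))) (0<* (0<ℕ→ℚ-suc 10343) 0<s))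
                (0≤* (0≤ℕ→ℚ 8640) (<⇒≤ 0<ε₂)))) (positive⁻¹ (+ 1 / 13824))))

ℕ→ℚ-∑-≤ : ∀ {n} c (f g : Fin n → ℕ) → (∀ i → ℕ→ℚ (f i) ≤ c * ℕ→ℚ (g i)) → ℕ→ℚ (sum f) ≤ c * ℕ→ℚ (sum g)
ℕ→ℚ-∑-≤ {zero}  c f g f≤cg = ≤-reflexive (sym (*-zeroʳ c))
ℕ→ℚ-∑-≤ {suc n} c f g f≤cg = begin
  ℕ→ℚ (f Fin.zero ℕ.+ sum (f ∘ Fin.suc))                 ≡⟨ ℕ→ℚ-+ (f Fin.zero) (sum (f ∘ Fin.suc)) ⟩
  ℕ→ℚ (f Fin.zero) + ℕ→ℚ (sum (f ∘ Fin.suc))              ≤⟨ +-mono-≤ (f≤cg Fin.zero) (ℕ→ℚ-∑-≤ c (f ∘ Fin.suc) (g ∘ Fin.suc) (f≤cg ∘ Fin.suc)) ⟩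
  c * ℕ→ℚ (g Fin.zero) + c * ℕ→ℚ (sum (g ∘ Fin.suc))      ≡⟨ *-distribˡ-+ c _ _ ⟨
  c * (ℕ→ℚ (g Fin.zero) + ℕ→ℚ (sum (g ∘ Fin.suc)))        ≡⟨ cong (c *_) (ℕ→ℚ-+ (g Fin.zero) (sum (g ∘ Fin.suc))) ⟨
  c * ℕ→ℚ (sum g)                                         ∎
  where open ≤-Reasoning

guarded-≤ : ∀ p x {c} → (p ≡ true → ℕ→ℚ x ≤ c) → ℕ→ℚ (𝟙 p ℕ.* x) ≤ c * ℕ→ℚ (𝟙 p)
guarded-≤ true  x {c} x≤c = subst₂ _≤_ (cong ℕ→ℚ (sym (ℕ.+-identityʳ x))) (sym (*-identityʳ c)) (x≤c refl)
guarded-≤ false x {c} _   = ≤-reflexive (sym (*-zeroʳ c))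

∧-does⇒ : ∀ {P : Set} b (P? : Dec P) → b ∧ does P? ≡ true → P
∧-does⇒ true  (yes p) _ = p
∧-does⇒ true  (no _)  ()
∧-does⇒ false _       ()

module FewBadPairs {n : ℕ} (T : Tournament n) (0<n : 0 ℕ.< n) (ε₁ ε₂ : ℚ) where

  bad : Fin n → Fin n → Bool
  bad u v = does (ℕ→ℚ (pairDeg T u v) ≤? ε₂ * ℕ→ℚ n)

  open Arcs T
  open ChosenArcs T bad

  B-size≡#chosen : B-size T ε₂ ≡ #chosen
  B-size≡#chosen = begin
    B-size T ε₂                                     ≡⟨ trans (sumFin≡∑ n _) (sum-cong-≗ {n} λ u → trans (countFin≡∑ n (λ v → (u <F v) ∧ bad u v))
                                                                                         (sum-cong-≗ {n} λ v → 𝟙-∧ (u <F v) (bad u v))) ⟩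
    ∑[ u < n ] ∑[ v < n ] (lt u v ℕ.* 𝟙 (bad u v))   ≡⟨ ∑-pairs≡∑-arcs (λ u v → 𝟙 (bad u v)) bad-sym ⟩
    ∑[ u < n ] ∑[ v < n ] (arc u v ℕ.* 𝟙 (bad u v))  ≡⟨ ∑²-cong {n} (λ u v → 𝟙-∧ (beats T u v) (bad u v)) ⟨
    #chosen                                         ∎
    where
    open ≡-Reasoning
    bad-sym : ∀ u v → 𝟙 (bad u v) ≡ 𝟙 (bad v u)
    bad-sym u v = cong (λ k → 𝟙 (does (ℕ→ℚ k ≤? ε₂ * ℕ→ℚ n))) (pairDeg-sym u v)

  ∑chosenPairDeg≤ : ℕ→ℚ ∑chosenPairDeg ≤ ε₂ * ℕ→ℚ n * ℕ→ℚ #chosen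
  ∑chosenPairDeg≤ = ℕ→ℚ-∑-≤ (ε₂ * ℕ→ℚ n) (λ u → ∑[ v < n ] (chosen u v ℕ.* pairDeg T u v)) chosenOut λ u →
                    ℕ→ℚ-∑-≤ (ε₂ * ℕ→ℚ n) (λ v → chosen u v ℕ.* pairDeg T u v) (chosen u) λ v →
                    guarded-≤ (beats T u v ∧ bad u v) (pairDeg T u v) (∧-does⇒ (beats T u v) (ℕ→ℚ (pairDeg T u v) ≤? ε₂ * ℕ→ℚ n))

  key-inequality-ℚ : (+ 6 / 1) * (ℕ→ℚ #chosen * ℕ→ℚ #chosen) + (+ 96 / 1) * ℕ→ℚ n * ℕ→ℚ (t T)
                     ≤ (+ 24 / 1) * ℕ→ℚ n * ℕ→ℚ ∑chosenPairDeg + (+ 4 / 1) * (ℕ→ℚ n * ℕ→ℚ n * ℕ→ℚ n * ℕ→ℚ n)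
  key-inequality-ℚ = subst₂ _≤_ lhs rhs (ℕ→ℚ-mono-≤ (key-inequality T bad))
    where
    lhs : ℕ→ℚ (6 ℕ.* (#chosen ℕ.* #chosen) ℕ.+ 96 ℕ.* n ℕ.* t T) ≡ (+ 6 / 1) * (ℕ→ℚ #chosen * ℕ→ℚ #chosen) + (+ 96 / 1) * ℕ→ℚ n * ℕ→ℚ (t T)
    lhs = trans (ℕ→ℚ-+ (6 ℕ.* (#chosen ℕ.* #chosen)) (96 ℕ.* n ℕ.* t T)) (cong₂ _+_
      (trans (ℕ→ℚ-* 6 (#chosen ℕ.* #chosen)) (cong (ℕ→ℚ 6 *_) (ℕ→ℚ-* #chosen #chosen)))
      (trans (ℕ→ℚ-* (96 ℕ.* n) (t T)) (cong (_* ℕ→ℚ (t T)) (ℕ→ℚ-* 96 n))))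
    rhs : ℕ→ℚ (24 ℕ.* n ℕ.* ∑chosenPairDeg ℕ.+ 4 ℕ.* (n ℕ.* n ℕ.* n ℕ.* n))
          ≡ (+ 24 / 1) * ℕ→ℚ n * ℕ→ℚ ∑chosenPairDeg + (+ 4 / 1) * (ℕ→ℚ n * ℕ→ℚ n * ℕ→ℚ n * ℕ→ℚ n)
    rhs = trans (ℕ→ℚ-+ (24 ℕ.* n ℕ.* ∑chosenPairDeg) (4 ℕ.* (n ℕ.* n ℕ.* n ℕ.* n))) (cong₂ _+_
      (trans (ℕ→ℚ-* (24 ℕ.* n) ∑chosenPairDeg) (cong (_* ℕ→ℚ ∑chosenPairDeg) (ℕ→ℚ-* 24 n)))
      (trans (ℕ→ℚ-* 4 (n ℕ.* n ℕ.* n ℕ.* n)) (cong (ℕ→ℚ 4 *_)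
        (trans (ℕ→ℚ-* (n ℕ.* n ℕ.* n) n) (cong (_* ℕ→ℚ n) (trans (ℕ→ℚ-* (n ℕ.* n) n) (cong (_* ℕ→ℚ n) (ℕ→ℚ-* n n))))))))

  few-bad-pairs : ∀ {δ} → 0ℚ < ε₂ → ε₂ < ε₁ * (+ 1 / 24) → δ < ε₁ * (ε₁ - (+ 4 / 1) * ε₂) * (+ 1 / 16) →
                  (+ 1 / 24 - δ) * (ℕ→ℚ n * ℕ→ℚ n * ℕ→ℚ n) ≤ ℕ→ℚ (t T) → ℕ→ℚ (B-size T ε₂) < ε₁ * (ℕ→ℚ n * ℕ→ℚ n)
  few-bad-pairs {δ} 0<ε₂ ε₂<ε₁/24 δ< t≥ = ≰⇒> λ B≥ →
    too-many-bad-pairs {ℕ→ℚ #chosen} {ℕ→ℚ n} {ℕ→ℚ (t T)} {ℕ→ℚ ∑chosenPairDeg} {ε₁} {ε₂} {δ}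
      (0<ℕ→ℚ 0<n) (0<ε₁ ε₁ ε₂ 0<ε₂ ε₂<ε₁/24) (0<ε₁-4ε₂ ε₁ ε₂ 0<ε₂ ε₂<ε₁/24) δ< key-inequality-ℚ ∑chosenPairDeg≤ t≥
      (subst (λ k → ε₁ * (ℕ→ℚ n * ℕ→ℚ n) ≤ ℕ→ℚ k) B-size≡#chosen B≥)

  few-pairs : 1ℚ < ε₁ → ℕ→ℚ (B-size T ε₂) < ε₁ * (ℕ→ℚ n * ℕ→ℚ n)
  few-pairs 1<ε₁ = begin-strict
    ℕ→ℚ (B-size T ε₂)      ≤⟨ ℕ→ℚ-mono-≤ (subst (ℕ._≤ n ℕ.* n) (sym B-size≡#chosen) #chosen≤n²) ⟩
    ℕ→ℚ (n ℕ.* n)          ≡⟨ ℕ→ℚ-* n n ⟩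
    ℕ→ℚ n * ℕ→ℚ n          ≡⟨ *-identityˡ (ℕ→ℚ n * ℕ→ℚ n) ⟨
    1ℚ * (ℕ→ℚ n * ℕ→ℚ n)   <⟨ *-monoˡ-<-pos (ℕ→ℚ n * ℕ→ℚ n) {{positive (0<* (0<ℕ→ℚ 0<n) (0<ℕ→ℚ 0<n))}} 1<ε₁ ⟩
    ε₁ * (ℕ→ℚ n * ℕ→ℚ n)   ∎
    where open ≤-Reasoning

  B-size-bound : 0ℚ < ε₂ → ε₂ < ε₁ * (+ 1 / 24) → (+ 1 / 24 - δ₀ ε₁ ε₂) * (ℕ→ℚ n * ℕ→ℚ n * ℕ→ℚ n) ≤ ℕ→ℚ (t T) →
                 ℕ→ℚ (B-size T ε₂) < ε₁ * (ℕ→ℚ n * ℕ→ℚ n)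
  B-size-bound 0<ε₂ ε₂<ε₁/24 t≥ = by-size (ε₁ ≤? 1ℚ)
    where
    by-size : Dec (ε₁ ≤ 1ℚ) → ℕ→ℚ (B-size T ε₂) < ε₁ * (ℕ→ℚ n * ℕ→ℚ n)
    by-size (yes ε₁≤1) = few-bad-pairs 0<ε₂ ε₂<ε₁/24 (δ₀<ε₁γ/16 ε₁ ε₂ 0<ε₂ ε₂<ε₁/24 ε₁≤1) t≥
    by-size (no ε₁≰1)  = few-pairs (≰⇒> ε₁≰1)

lemma3p8 : ∀ (ε₁ ε₂ : ℚ) → ε₂ < (ε₁ * (+ 1 / 24)) → 0ℚ < ε₂ →
    ∃ λ (δ : ℚ) → ∃ λ (N : ℕ) →
    ((ε₁ * ε₁ * (ε₁ - (+ 24 / 1) * ε₂)) * (+ 1 / 13824) < δ) ×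
    (∀ (n : ℕ) (T : Tournament n) → N Data.Nat.< n →
    ((+ 1 / 24 - δ) * (ℕ→ℚ n * ℕ→ℚ n * ℕ→ℚ n) ≤ ℕ→ℚ (t T)) →
    ℕ→ℚ (B-size T ε₂) < ε₁ * (ℕ→ℚ n * ℕ→ℚ n))
lemma3p8 ε₁ ε₂ ε₂<ε₁/24 0<ε₂ = δ₀ ε₁ ε₂ , 0 , bound<δ₀ ε₁ ε₂ 0<ε₂ ε₂<ε₁/24 ,
  λ n T 0<n → FewBadPairs.B-size-bound T 0<n ε₁ ε₂ 0<ε₂ ε₂<ε₁/24
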